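{- Let $n\ge0$, $x_1,\dots,x_{n+1}$ variables, $\mathbf{x}=(x_1,\dots,x_n)$, and let $\lambda=(\lambda_1,\dots,\lambda_n)$ be a partition (trailing zeros allowed), regarded as the partition $(\lambda_1,\dots,\lambda_n,0)$ with $n+1$ parts. Then $$sp_\lambda(\mathbf{x}^{\pm};x_{n+1})=\sum x_{n+1}^{|z_{2n+1}|-|z_{2n}|}\prod_{i=1}^n x_i^{2|z_{2i-1}|-|z_{2i}|-|z_{2i-2}|},$$ where the sum runs over all sequences of partitions $\emptyset=z_0\prec z_1\prec\cdots\prec z_{2n}\prec z_{2n+1}=\lambda$ in which $z_k=(z_{k,1},\dots,z_{k,\lceil k/2\rceil})$ has $\lceil k/2\rceil$ (nonnegative) parts and which satisfy the symplectic Gelfand–Tsetlin condition $z_{k+1,j}\le z_{k,j-1}\le z_{k+1,j-1}$ for $2\le j\le\lceil (k+1)/2\rceil$.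
   Context: For partitions $\nu,\kappa$ (with missing parts taken to be $0$), $\nu\prec\kappa$ means $\kappa_i\ge\nu_i\ge\kappa_{i+1}$ for all $i$; $|\nu|$ is the sum of the parts. The odd symplectic character, for $\lambda=(\lambda_1,\dots,\lambda_{n+1})$ and $z=x_{n+1}$, is $sp_\lambda(\mathbf{x}^{\pm};z)=\det(a_{ij})_{i,j=1}^{n+1}/\det(b_{ij})_{i,j=1}^{n+1}$ with $a_{ij}=x_i^{\lambda_j+n-j+2}-x_i^{ -\lambda_j-(n-j+2)}-z^{ -1}\big(x_i^{\lambda_j+n-j+1}-x_i^{ -\lambda_j-(n-j+1)}\big)$ for $1\le i\le n$, $a_{n+1,j}=z^{\lambda_j+n-j+2}-z^{\lambda_j+n-j}$, $b_{ij}=x_i^{n-j+2}-x_i^{ -(n-j+2)}$ for $1\le i\le n$, $b_{n+1,j}=z^{n-j+2}-z^{ -(n-j+2)}$. -}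

module Defs where

open import Data.Nat as ℕ using (ℕ; zero; suc; _≤_; _<_; _∸_; ⌈_/2⌉)
open import Data.Integer as ℤ using (ℤ; +_; -[1+_])
open import Data.Rational as ℚ using (ℚ; 0ℚ; 1ℚ; _+_; _*_; _-_; -_; 1/_; ≢-nonZero)
open import Data.Rational.Properties using (_≟_)
open import Data.Fin as Fin using (Fin; toℕ; fromℕ; inject₁; punchIn)
open import Data.Fin.Properties as FinP using ()
open import Data.List as List using (List; []; _∷_; _++_; [_])
open import Data.Vec as Vec using (Vec; lookup; toList)
open import Data.Product using (_×_)
open import Relation.Nullary using (yes; no)
open import Relation.Binary.PropositionalEquality using (_≡_)

-- total inverse (0 ↦ 0); only ever used at nonzero arguments
inv : ℚ → ℚ
inv p with p ≟ 0ℚ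
... | yes _ = 0ℚ
... | no ne = 1/_ p {{≢-nonZero ne}}

pow : ℚ → ℕ → ℚ
pow x zero = 1ℚ
pow x (suc k) = x * pow x k

ipow : ℚ → ℤ → ℚ
ipow x (+ k) = pow x k
ipow x -[1+ k ] = pow (inv x) (suc k)

sumFin : ∀ {n} → (Fin n → ℚ) → ℚ
sumFin {zero} f = 0ℚ
sumFin {suc n} f = f Fin.zero + sumFin (λ i → f (Fin.suc i))

prodFin : ∀ {n} → (Fin n → ℚ) → ℚ
prodFin {zero} f = 1ℚ
prodFin {suc n} f = f Fin.zero * prodFin (λ i → f (Fin.suc i))

sumList : List ℚ → ℚ
sumList = List.foldr _+_ 0ℚ

det : ∀ {n} → (Fin n → Fin n → ℚ) → ℚ
det {zero} M = 1ℚ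
det {suc n} M =
  sumFin (λ j → pow (- 1ℚ) (toℕ j) * M Fin.zero j
                * det (λ i k → M (Fin.suc i) (punchIn j k)))

-- i-th part (0-based), 0 if missing
part : List ℕ → ℕ → ℕ
part [] i = 0
part (a ∷ l) zero = a
part (a ∷ l) (suc i) = part l i

size : List ℕ → ℕ
size = List.foldr ℕ._+_ 0

IsPartition : List ℕ → Set
IsPartition l = ∀ i → part l (suc i) ≤ part l i

_≺_ : List ℕ → List ℕ → Set
ν ≺ κ = ∀ i → (part ν i ≤ part κ i) × (part κ (suc i) ≤ part ν i)

-- The odd symplectic character (evaluated at a point of ℚ)
-- x : Fin (suc n) → ℚ ; x_1..x_n are x (inject₁ i), z = x_{n+1} = x (fromℕ n)
-- la : Fin (suc n) → ℕ  are the n+1 parts λ_1..λ_{n+1}; column j has j0 = toℕ j = j-1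

zOf : ∀ {n} → (Fin (suc n) → ℚ) → ℚ
zOf {n} x = x (fromℕ n)

dif : ℚ → ℤ → ℚ
dif y k = ipow y k - ipow y (ℤ.- k)

aMat : (n : ℕ) → (Fin (suc n) → ℕ) → (Fin (suc n) → ℚ) → Fin (suc n) → Fin (suc n) → ℚ
aMat n la x i j with i FinP.≟ fromℕ n
... | yes _ = ipow (zOf x) (+ p) - ipow (zOf x) (+ p ℤ.- + 2)
  where p = la j ℕ.+ (suc n ∸ toℕ j)      -- λ_j + n - j + 2
... | no _ = dif (x i) (+ p) - inv (zOf x) * dif (x i) (+ q)
  where p = la j ℕ.+ (suc n ∸ toℕ j)      -- λ_j + n - j + 2
        q = la j ℕ.+ (n ∸ toℕ j)          -- λ_j + n - j + 1

bMat : (n : ℕ) → (Fin (suc n) → ℚ) → Fin (suc n) → Fin (suc n) → ℚ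
bMat n x i j with i FinP.≟ fromℕ n
... | yes _ = dif (zOf x) (+ (suc n ∸ toℕ j))
... | no _ = dif (x i) (+ (suc n ∸ toℕ j))

sp : (n : ℕ) → (Fin (suc n) → ℕ) → (Fin (suc n) → ℚ) → ℚ
sp n la x = det (aMat n la x) * inv (det (bMat n x))

Pat : ℕ → Set
Pat n = Vec (List ℕ) (suc (suc (2 ℕ.* n)))

-- z_k (as a list of parts); [] beyond the range
zAt : (n : ℕ) → Pat n → ℕ → List ℕ
zAt n z k = go (toList z) k
  where
  go : List (List ℕ) → ℕ → List ℕ
  go [] _ = []
  go (a ∷ l) zero = a
  go (a ∷ l) (suc k) = go l k

extend : ∀ {n} → Vec ℕ n → List ℕ
extend la = toList la ++ [ 0 ]

record ValidGT (n : ℕ) (la : Vec ℕ n) (z : Pat n) : Set where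
  field
    lengths    : ∀ (k : Fin (suc (suc (2 ℕ.* n)))) → List.length (lookup z k) ≡ ⌈ toℕ k /2⌉
    partitions : ∀ (k : Fin (suc (suc (2 ℕ.* n)))) → IsPartition (lookup z k)
    bottom     : zAt n z 0 ≡ []
    top        : zAt n z (suc (2 ℕ.* n)) ≡ extend la
    interlace  : ∀ k → k < suc (2 ℕ.* n) → zAt n z k ≺ zAt n z (suc k)
    -- z_{k+1,j} ≤ z_{k,j-1} ≤ z_{k+1,j-1} for 2 ≤ j ≤ ⌈(k+1)/2⌉  (here i = j-2, 0-based parts)
    symplectic : ∀ k → k < suc (2 ℕ.* n) → ∀ i → suc (suc i) ≤ ⌈ suc k /2⌉ →
                 (part (zAt n z (suc k)) (suc i) ≤ part (zAt n z k) i)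
                 × (part (zAt n z k) i ≤ part (zAt n z (suc k)) i)

sz : (n : ℕ) → Pat n → ℕ → ℤ
sz n z k = + size (zAt n z k)

weight : (n : ℕ) → (Fin (suc n) → ℚ) → Pat n → ℚ
weight n x z =
  ipow (zOf x) (sz n z (suc (2 ℕ.* n)) ℤ.- sz n z (2 ℕ.* n))
  * prodFin {n} (λ i → let m = toℕ i in
      ipow (x (inject₁ i))
        (+ 2 ℤ.* sz n z (suc (2 ℕ.* m)) ℤ.- sz n z (suc (suc (2 ℕ.* m))) ℤ.- sz n z (2 ℕ.* m)))

laCol : ∀ {n} → Vec ℕ n → Fin (suc n) → ℕ
laCol la j = part (extend la) (toℕ j)

{-# OPTIONS --safe #-}
-- Write z = x_{n+1}. Adding to each column of the odd determinant -z^(λⱼ - λⱼ₊₁ + 1) times the next one empties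
-- the row of z except for its last entry z^(λ_{n+1}) (z - z⁻¹), and by a telescoping identity turns row i into
-- ((xᵢ + xᵢ⁻¹) - (z + z⁻¹)) times a sum over μ ≺ λ of z^(λⱼ - μⱼ) times the symplectic numerator of μ in
-- x₁, …, x_n. The same column operations with x_n⁻¹ expand that numerator as a sum over ν ≺ μ of odd numerators
-- in x₁, …, x_n with last variable x_n, weighted by x_n^(νⱼ - μⱼ). The Weyl denominator is the symplectic
-- numerator of ∅, so it factors in the same way, and induction on n matches the quotient with the sum over
-- patterns ending in ν ≺ μ ≺ λ: their last layers contribute z^(|λ| - |μ|) x_n^(|ν| - |μ|) to the weight.
module Submission where

open import Defs
open import Data.Nat as ℕ using (ℕ; zero; suc; _∸_; _≤_; _<_; z≤n; s≤s; ⌈_/2⌉)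
import Data.Nat.Properties as ℕₚ
open import Data.Integer as ℤ using (ℤ; -[1+_]; _⊖_)
import Data.Integer.Properties as ℤₚ
open import Data.Rational using (ℚ; 0ℚ; 1ℚ; _+_; _*_; _-_; -_; ≢-nonZero)
import Data.Rational.Properties as ℚₚ
open import Data.Fin as Fin using (Fin; zero; suc; toℕ; fromℕ; fromℕ<; inject₁; punchIn; punchOut)
import Data.Fin.Properties as Finₚ
open import Data.List as List using (List; []; _∷_; _++_; [_]; map; concatMap; length; replicate)
import Data.List.Properties as Listₚ
import Data.Nat.ListAction.Properties as ℕ-List
open import Data.List.Membership.Propositional using (_∈_; find; lose)
import Data.List.Membership.Propositional.Properties as ∈ₚ
open import Data.List.Relation.Unary.Any using (here; there)
open import Data.List.Relation.Unary.All as All using (All)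
open import Data.List.Relation.Unary.AllPairs using ([]; _∷_)
open import Data.List.Relation.Unary.Unique.Propositional using (Unique)
import Data.List.Relation.Unary.Unique.Propositional.Properties as Uniqueₚ
open import Data.Vec as Vec using (Vec; toList; lookup)
import Data.Vec.Properties as Vecₚ
open import Data.Product using (Σ; _×_; _,_; proj₁; proj₂)
open import Data.Sum using (_⊎_; inj₁; inj₂)
open import Data.Empty using (⊥; ⊥-elim)
open import Relation.Nullary using (¬_; Dec; yes; no)
open import Relation.Nullary.Decidable using (dec⇒maybe)
open import Relation.Binary.PropositionalEquality hiding ([_])
open import Function using (_∘_)
open import Tactic.RingSolver using (solve-∀)
open import Tactic.RingSolver.Core.AlmostCommutativeRing using (AlmostCommutativeRing; fromCommutativeRing)
import Data.Nat.Tactic.RingSolver as ℕ-Solver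
import Data.Integer.Tactic.RingSolver as ℤ-Solver

open ≡-Reasoning

ℚ-ring : AlmostCommutativeRing _ _
ℚ-ring = fromCommutativeRing ℚₚ.+-*-commutativeRing (λ x → dec⇒maybe (0ℚ ℚₚ.≟ x))

-- Finite sums and determinants

sumFin-cong : ∀ {n} {f g : Fin n → ℚ} → (∀ i → f i ≡ g i) → sumFin f ≡ sumFin g
sumFin-cong {zero} f≗g = refl
sumFin-cong {suc n} f≗g = cong₂ _+_ (f≗g zero) (sumFin-cong (f≗g ∘ suc))

sumFin-+ : ∀ {n} (f g : Fin n → ℚ) → sumFin (λ i → f i + g i) ≡ sumFin f + sumFin g
sumFin-+ {zero} f g = refl
sumFin-+ {suc n} f g =
  trans (cong ((f zero + g zero) +_) (sumFin-+ (f ∘ suc) (g ∘ suc)))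
        (swap-middle (f zero) (g zero) (sumFin (f ∘ suc)) (sumFin (g ∘ suc)))
  where
  swap-middle : ∀ a b c d → (a + b) + (c + d) ≡ (a + c) + (b + d)
  swap-middle = solve-∀ ℚ-ring

sumFin-*ˡ : ∀ {n} (c : ℚ) (f : Fin n → ℚ) → sumFin (λ i → c * f i) ≡ c * sumFin f
sumFin-*ˡ {zero} c f = sym (ℚₚ.*-zeroʳ c)
sumFin-*ˡ {suc n} c f =
  trans (cong (c * f zero +_) (sumFin-*ˡ c (f ∘ suc))) (sym (ℚₚ.*-distribˡ-+ c _ _))

sumFin-zero : ∀ {n} (f : Fin n → ℚ) → (∀ i → f i ≡ 0ℚ) → sumFin f ≡ 0ℚ
sumFin-zero {zero} f f≗0 = refl
sumFin-zero {suc n} f f≗0 = cong₂ _+_ (f≗0 zero) (sumFin-zero (f ∘ suc) (f≗0 ∘ suc))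

sumFin-single : ∀ {n} (f : Fin n → ℚ) (p : Fin n) → (∀ k → k ≢ p → f k ≡ 0ℚ) → sumFin f ≡ f p
sumFin-single {suc n} f zero f≗0 =
  trans (cong (f zero +_) (sumFin-zero (f ∘ suc) (λ i → f≗0 (suc i) (λ ())))) (ℚₚ.+-identityʳ _)
sumFin-single {suc n} f (suc p) f≗0 =
  trans (cong₂ _+_ (f≗0 zero (λ ())) (sumFin-single (f ∘ suc) p (λ k k≢p → f≗0 (suc k) (k≢p ∘ Finₚ.suc-injective))))
        (ℚₚ.+-identityˡ _)

sumFin-pair : ∀ {n} (f : Fin n → ℚ) (p q : Fin n) → p ≢ q → (∀ k → k ≢ p → k ≢ q → f k ≡ 0ℚ) →
              sumFin f ≡ f p + f q
sumFin-pair {suc n} f zero zero p≢q f≗0 = ⊥-elim (p≢q refl)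
sumFin-pair {suc n} f zero (suc q) p≢q f≗0 =
  cong (f zero +_) (sumFin-single (f ∘ suc) q (λ k k≢q → f≗0 (suc k) (λ ()) (k≢q ∘ Finₚ.suc-injective)))
sumFin-pair {suc n} f (suc p) zero p≢q f≗0 =
  trans (cong (f zero +_) (sumFin-single (f ∘ suc) p (λ k k≢p → f≗0 (suc k) (k≢p ∘ Finₚ.suc-injective) (λ ()))))
        (ℚₚ.+-comm (f zero) (f (suc p)))
sumFin-pair {suc n} f (suc p) (suc q) p≢q f≗0 =
  trans (cong₂ _+_ (f≗0 zero (λ ()) (λ ()))
                   (sumFin-pair (f ∘ suc) p q (p≢q ∘ cong suc)
                      (λ k k≢p k≢q → f≗0 (suc k) (k≢p ∘ Finₚ.suc-injective) (k≢q ∘ Finₚ.suc-injective))))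
        (ℚₚ.+-identityˡ _)

sumFin-init-last : ∀ {n} (f : Fin (suc n) → ℚ) → sumFin f ≡ sumFin (f ∘ inject₁) + f (fromℕ n)
sumFin-init-last {zero} f = trans (ℚₚ.+-identityʳ (f zero)) (sym (ℚₚ.+-identityˡ (f zero)))
sumFin-init-last {suc n} f =
  trans (cong (f zero +_) (sumFin-init-last (f ∘ suc))) (sym (ℚₚ.+-assoc (f zero) _ (f (fromℕ (suc n)))))

prodFin-cong : ∀ {n} {f g : Fin n → ℚ} → (∀ i → f i ≡ g i) → prodFin f ≡ prodFin g
prodFin-cong {zero} f≗g = refl
prodFin-cong {suc n} f≗g = cong₂ _*_ (f≗g zero) (prodFin-cong (f≗g ∘ suc))

prodFin-init-last : ∀ {n} (f : Fin (suc n) → ℚ) → prodFin f ≡ prodFin (f ∘ inject₁) * f (fromℕ n)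
prodFin-init-last {zero} f = trans (ℚₚ.*-identityʳ (f zero)) (sym (ℚₚ.*-identityˡ (f zero)))
prodFin-init-last {suc n} f =
  trans (cong (f zero *_) (prodFin-init-last (f ∘ suc))) (sym (ℚₚ.*-assoc (f zero) _ (f (fromℕ (suc n)))))

Matrix : ℕ → Set
Matrix n = Fin n → Fin n → ℚ

sign : ∀ {n} → Fin n → ℚ
sign j = pow (- 1ℚ) (toℕ j)

minor : ∀ {n} → Matrix (suc n) → Fin (suc n) → Matrix n
minor M j i k = M (suc i) (punchIn j k)

cofactorTerm : ∀ {n} → Matrix (suc n) → Fin (suc n) → ℚ
cofactorTerm M j = sign j * M zero j * det (minor M j)

det-cong : ∀ {n} {M N : Matrix n} → (∀ i j → M i j ≡ N i j) → det M ≡ det N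
det-cong {zero} M≗N = refl
det-cong {suc n} M≗N =
  sumFin-cong (λ j → cong₂ _*_ (cong (sign j *_) (M≗N zero j)) (det-cong (λ i k → M≗N (suc i) (punchIn j k))))

det-zeroRow : ∀ {n} (M : Matrix n) (r : Fin n) → (∀ j → M r j ≡ 0ℚ) → det M ≡ 0ℚ
det-zeroRow {suc n} M zero M₀≗0 = sumFin-zero (cofactorTerm M) term≡0
  where
  term≡0 : ∀ j → cofactorTerm M j ≡ 0ℚ
  term≡0 j = begin
    sign j * M zero j * det (minor M j) ≡⟨ cong (λ m → sign j * m * det (minor M j)) (M₀≗0 j) ⟩
    sign j * 0ℚ * det (minor M j)       ≡⟨ cong (_* det (minor M j)) (ℚₚ.*-zeroʳ (sign j)) ⟩
    0ℚ * det (minor M j)                ≡⟨ ℚₚ.*-zeroˡ (det (minor M j)) ⟩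
    0ℚ                                  ∎
det-zeroRow {suc n} M (suc r) Mᵣ≗0 = sumFin-zero (cofactorTerm M) term≡0
  where
  term≡0 : ∀ j → cofactorTerm M j ≡ 0ℚ
  term≡0 j = trans (cong (sign j * M zero j *_) (det-zeroRow (minor M j) r (Mᵣ≗0 ∘ punchIn j)))
                   (ℚₚ.*-zeroʳ (sign j * M zero j))

det-scaleRows : ∀ {n} (c : Fin n → ℚ) (M : Matrix n) → det (λ i j → c i * M i j) ≡ prodFin c * det M
det-scaleRows {zero} c M = sym (ℚₚ.*-identityʳ 1ℚ)
det-scaleRows {suc n} c M =
  trans (sumFin-cong term) (sumFin-*ˡ (c zero * prodFin (c ∘ suc)) (cofactorTerm M))
  where
  regroup : ∀ s k m p d → s * (k * m) * (p * d) ≡ (k * p) * (s * m * d)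
  regroup = solve-∀ ℚ-ring
  term : ∀ j → sign j * (c zero * M zero j) * det (λ i k → c (suc i) * minor M j i k)
             ≡ (c zero * prodFin (c ∘ suc)) * cofactorTerm M j
  term j = trans (cong (sign j * (c zero * M zero j) *_) (det-scaleRows (c ∘ suc) (minor M j)))
                 (regroup (sign j) (c zero) (M zero j) (prodFin (c ∘ suc)) (det (minor M j)))

det-linearCol : ∀ {n} (M M₁ M₂ : Matrix n) (j : Fin n) (a b : ℚ) →
                (∀ i k → k ≢ j → M i k ≡ M₁ i k) → (∀ i k → k ≢ j → M i k ≡ M₂ i k) →
                (∀ i → M i j ≡ a * M₁ i j + b * M₂ i j) →
                det M ≡ a * det M₁ + b * det M₂
det-linearCol {suc n} M M₁ M₂ j a b M≗M₁ M≗M₂ Mⱼ =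
  begin
    sumFin (cofactorTerm M)                                           ≡⟨ sumFin-cong term ⟩
    sumFin (λ k → a * cofactorTerm M₁ k + b * cofactorTerm M₂ k)
      ≡⟨ sumFin-+ (λ k → a * cofactorTerm M₁ k) (λ k → b * cofactorTerm M₂ k) ⟩
    sumFin (λ k → a * cofactorTerm M₁ k) + sumFin (λ k → b * cofactorTerm M₂ k)
      ≡⟨ cong₂ _+_ (sumFin-*ˡ a (cofactorTerm M₁)) (sumFin-*ˡ b (cofactorTerm M₂)) ⟩
    a * det M₁ + b * det M₂                                           ∎
  where
  expandEntry : ∀ a b s m₁ m₂ d → s * (a * m₁ + b * m₂) * d ≡ a * (s * m₁ * d) + b * (s * m₂ * d)
  expandEntry = solve-∀ ℚ-ring
  expandMinor : ∀ a b s m d₁ d₂ → s * m * (a * d₁ + b * d₂) ≡ a * (s * m * d₁) + b * (s * m * d₂)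
  expandMinor = solve-∀ ℚ-ring
  term : ∀ k → cofactorTerm M k ≡ a * cofactorTerm M₁ k + b * cofactorTerm M₂ k
  term k with k Fin.≟ j
  ... | yes refl =
    begin
      sign k * M zero k * det (minor M k)
        ≡⟨ cong (λ m → sign k * m * det (minor M k)) (Mⱼ zero) ⟩
      sign k * (a * M₁ zero k + b * M₂ zero k) * det (minor M k)
        ≡⟨ expandEntry a b (sign k) (M₁ zero k) (M₂ zero k) (det (minor M k)) ⟩
      a * (sign k * M₁ zero k * det (minor M k)) + b * (sign k * M₂ zero k * det (minor M k))
        ≡⟨ cong₂ (λ d₁ d₂ → a * (sign k * M₁ zero k * d₁) + b * (sign k * M₂ zero k * d₂))
                 (det-cong (λ i c → M≗M₁ (suc i) (punchIn k c) (Finₚ.punchInᵢ≢i k c)))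
                 (det-cong (λ i c → M≗M₂ (suc i) (punchIn k c) (Finₚ.punchInᵢ≢i k c))) ⟩
      a * cofactorTerm M₁ k + b * cofactorTerm M₂ k
    ∎
  ... | no k≢j =
    begin
      sign k * M zero k * det (minor M k)
        ≡⟨ cong (sign k * M zero k *_) minor-linear ⟩
      sign k * M zero k * (a * det (minor M₁ k) + b * det (minor M₂ k))
        ≡⟨ expandMinor a b (sign k) (M zero k) (det (minor M₁ k)) (det (minor M₂ k)) ⟩
      a * (sign k * M zero k * det (minor M₁ k)) + b * (sign k * M zero k * det (minor M₂ k))
        ≡⟨ cong₂ (λ m₁ m₂ → a * (sign k * m₁ * det (minor M₁ k)) + b * (sign k * m₂ * det (minor M₂ k)))
                 (M≗M₁ zero k k≢j) (M≗M₂ zero k k≢j) ⟩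
      a * cofactorTerm M₁ k + b * cofactorTerm M₂ k
    ∎
    where
    j′ = punchOut k≢j
    punchIn-j′ : punchIn k j′ ≡ j
    punchIn-j′ = Finₚ.punchIn-punchOut k≢j
    avoids-j : ∀ c → c ≢ j′ → punchIn k c ≢ j
    avoids-j c c≢j′ eq = c≢j′ (Finₚ.punchIn-injective k c j′ (trans eq (sym punchIn-j′)))
    minor-linear : det (minor M k) ≡ a * det (minor M₁ k) + b * det (minor M₂ k)
    minor-linear =
      det-linearCol (minor M k) (minor M₁ k) (minor M₂ k) j′ a b
        (λ i c c≢j′ → M≗M₁ (suc i) (punchIn k c) (avoids-j c c≢j′))
        (λ i c c≢j′ → M≗M₂ (suc i) (punchIn k c) (avoids-j c c≢j′))
        (λ i → subst (λ c → M (suc i) c ≡ a * M₁ (suc i) c + b * M₂ (suc i) c) (sym punchIn-j′) (Mⱼ (suc i)))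

punchOut-adjacent : ∀ {n} (k p q : Fin (suc n)) (k≢p : k ≢ p) (k≢q : k ≢ q) → toℕ q ≡ suc (toℕ p) →
                    toℕ (punchOut k≢q) ≡ suc (toℕ (punchOut k≢p))
punchOut-adjacent zero zero q k≢p k≢q q≡p+1 = ⊥-elim (k≢p refl)
punchOut-adjacent zero (suc p) (suc q) k≢p k≢q q≡p+1 = ℕₚ.suc-injective q≡p+1
punchOut-adjacent {suc n} (suc zero) zero (suc zero) k≢p k≢q q≡p+1 = ⊥-elim (k≢q refl)
punchOut-adjacent {suc (suc n)} (suc (suc k)) zero (suc zero) k≢p k≢q q≡p+1 = refl
punchOut-adjacent {suc n} (suc k) (suc p) (suc q) k≢p k≢q q≡p+1 =
  cong suc (punchOut-adjacent k p q (k≢p ∘ cong suc) (k≢q ∘ cong suc) (ℕₚ.suc-injective q≡p+1))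

punchIn-adjacent : ∀ {n} (p q : Fin (suc n)) → toℕ q ≡ suc (toℕ p) → ∀ c →
                   (punchIn p c ≡ punchIn q c) ⊎ ((punchIn p c ≡ q) × (punchIn q c ≡ p))
punchIn-adjacent zero (suc zero) q≡p+1 zero = inj₂ (refl , refl)
punchIn-adjacent zero (suc zero) q≡p+1 (suc c) = inj₁ refl
punchIn-adjacent {suc n} (suc p) (suc q) q≡p+1 zero = inj₁ refl
punchIn-adjacent {suc n} (suc p) (suc q) q≡p+1 (suc c) with punchIn-adjacent p q (ℕₚ.suc-injective q≡p+1) c
... | inj₁ same = inj₁ (cong suc same)
... | inj₂ (p↦q , q↦p) = inj₂ (cong suc p↦q , cong suc q↦p)

det-adjacentEqualCols : ∀ {n} (M : Matrix n) (p q : Fin n) → toℕ q ≡ suc (toℕ p) →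
                        (∀ i → M i p ≡ M i q) → det M ≡ 0ℚ
det-adjacentEqualCols {suc n} M p q q≡p+1 Mₚ≗M_q =
  trans (sumFin-pair (cofactorTerm M) p q p≢q other≡0) terms-cancel
  where
  p≢q : p ≢ q
  p≢q p≡q = ℕₚ.1+n≢n (sym (trans (cong toℕ p≡q) q≡p+1))
  other≡0 : ∀ k → k ≢ p → k ≢ q → cofactorTerm M k ≡ 0ℚ
  other≡0 k k≢p k≢q =
    trans (cong (sign k * M zero k *_) minor≡0) (ℚₚ.*-zeroʳ (sign k * M zero k))
    where
    minor≡0 : det (minor M k) ≡ 0ℚ
    minor≡0 = det-adjacentEqualCols (minor M k) (punchOut k≢p) (punchOut k≢q)
                (punchOut-adjacent k p q k≢p k≢q q≡p+1)
                (λ i → begin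
                   M (suc i) (punchIn k (punchOut k≢p)) ≡⟨ cong (M (suc i)) (Finₚ.punchIn-punchOut k≢p) ⟩
                   M (suc i) p                          ≡⟨ Mₚ≗M_q (suc i) ⟩
                   M (suc i) q                          ≡⟨ cong (M (suc i)) (Finₚ.punchIn-punchOut k≢q) ⟨
                   M (suc i) (punchIn k (punchOut k≢q)) ∎)
  same-minors : det (minor M p) ≡ det (minor M q)
  same-minors = det-cong (λ i c → entry i c (punchIn-adjacent p q q≡p+1 c))
    where
    entry : ∀ i c → (punchIn p c ≡ punchIn q c) ⊎ ((punchIn p c ≡ q) × (punchIn q c ≡ p)) →
            M (suc i) (punchIn p c) ≡ M (suc i) (punchIn q c)
    entry i c (inj₁ same) = cong (M (suc i)) same
    entry i c (inj₂ (p↦q , q↦p)) =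
      trans (cong (M (suc i)) p↦q) (trans (sym (Mₚ≗M_q (suc i))) (sym (cong (M (suc i)) q↦p)))
  sign-q : sign q ≡ - sign p
  sign-q rewrite q≡p+1 = trans (sym (ℚₚ.neg-distribˡ-* 1ℚ (sign p))) (cong -_ (ℚₚ.*-identityˡ (sign p)))
  cancel : ∀ s m d → s * m * d + (- s) * m * d ≡ 0ℚ
  cancel = solve-∀ ℚ-ring
  terms-cancel : cofactorTerm M p + cofactorTerm M q ≡ 0ℚ
  terms-cancel = begin
    cofactorTerm M p + sign q * M zero q * det (minor M q)
      ≡⟨ cong₂ (λ s m → cofactorTerm M p + s * m * det (minor M q)) sign-q (sym (Mₚ≗M_q zero)) ⟩
    cofactorTerm M p + (- sign p) * M zero p * det (minor M q)
      ≡⟨ cong (λ d → cofactorTerm M p + (- sign p) * M zero p * d) (sym same-minors) ⟩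
    cofactorTerm M p + (- sign p) * M zero p * det (minor M p)
      ≡⟨ cancel (sign p) (M zero p) (det (minor M p)) ⟩
    0ℚ ∎

punchIn-fromℕ : ∀ {n} (c : Fin n) → punchIn (fromℕ n) c ≡ inject₁ c
punchIn-fromℕ zero = refl
punchIn-fromℕ (suc c) = cong suc (punchIn-fromℕ c)

punchIn-inject₁ : ∀ {n} (k : Fin (suc n)) (c : Fin n) → punchIn (inject₁ k) (inject₁ c) ≡ inject₁ (punchIn k c)
punchIn-inject₁ zero c = refl
punchIn-inject₁ (suc k) zero = refl
punchIn-inject₁ (suc k) (suc c) = cong suc (punchIn-inject₁ k c)

punchIn-inject₁-fromℕ : ∀ {n} (k : Fin (suc n)) → punchIn (inject₁ k) (fromℕ n) ≡ fromℕ (suc n)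
punchIn-inject₁-fromℕ zero = refl
punchIn-inject₁-fromℕ {suc n} (suc k) = cong suc (punchIn-inject₁-fromℕ k)

det-lastRow : ∀ {n} (M : Matrix (suc n)) → (∀ j → M (fromℕ n) (inject₁ j) ≡ 0ℚ) →
              det M ≡ M (fromℕ n) (fromℕ n) * det (λ i j → M (inject₁ i) (inject₁ j))
det-lastRow {zero} M _ = trans (ℚₚ.+-identityʳ _) (cong (_* 1ℚ) (ℚₚ.*-identityˡ (M zero zero)))
det-lastRow {suc n} M lastRow≗0 = begin
  sumFin (cofactorTerm M)
    ≡⟨ sumFin-init-last (cofactorTerm M) ⟩
  sumFin (cofactorTerm M ∘ inject₁) + cofactorTerm M (fromℕ (suc n))
    ≡⟨ cong₂ _+_ (sumFin-cong inner-term) last-term≡0 ⟩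
  sumFin (λ k → corner * cofactorTerm M′ k) + 0ℚ
    ≡⟨ ℚₚ.+-identityʳ _ ⟩
  sumFin (λ k → corner * cofactorTerm M′ k)
    ≡⟨ sumFin-*ˡ corner (cofactorTerm M′) ⟩
  corner * det M′ ∎
  where
  corner = M (fromℕ (suc n)) (fromℕ (suc n))
  M′ : Matrix (suc n)
  M′ i j = M (inject₁ i) (inject₁ j)
  last-term≡0 : cofactorTerm M (fromℕ (suc n)) ≡ 0ℚ
  last-term≡0 =
    trans (cong (sign (fromℕ (suc n)) * M zero (fromℕ (suc n)) *_)
                (det-zeroRow (minor M (fromℕ (suc n))) (fromℕ n)
                   (λ c → trans (cong (M (fromℕ (suc n))) (punchIn-fromℕ c)) (lastRow≗0 c))))
          (ℚₚ.*-zeroʳ (sign (fromℕ (suc n)) * M zero (fromℕ (suc n))))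
  pull-corner : ∀ s m a d → s * m * (a * d) ≡ a * (s * m * d)
  pull-corner = solve-∀ ℚ-ring
  inner-term : ∀ k → cofactorTerm M (inject₁ k) ≡ corner * cofactorTerm M′ k
  inner-term k = begin
    sign (inject₁ k) * M zero (inject₁ k) * det (minor M (inject₁ k))
      ≡⟨ cong (sign (inject₁ k) * M zero (inject₁ k) *_) minor-lastRow ⟩
    sign (inject₁ k) * M zero (inject₁ k) * (corner * det (minor M′ k))
      ≡⟨ pull-corner (sign (inject₁ k)) (M zero (inject₁ k)) corner (det (minor M′ k)) ⟩
    corner * (sign (inject₁ k) * M zero (inject₁ k) * det (minor M′ k))
      ≡⟨ cong (λ t → corner * (pow (- 1ℚ) t * M zero (inject₁ k) * det (minor M′ k))) (Finₚ.toℕ-inject₁ k) ⟩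
    corner * cofactorTerm M′ k ∎
    where
    minor-lastRow : det (minor M (inject₁ k)) ≡ corner * det (minor M′ k)
    minor-lastRow =
      trans (det-lastRow (minor M (inject₁ k))
               (λ c → trans (cong (M (fromℕ (suc n))) (punchIn-inject₁ k c)) (lastRow≗0 (punchIn k c))))
            (cong₂ _*_ (cong (M (fromℕ (suc n))) (punchIn-inject₁-fromℕ k))
                       (det-cong (λ i c → cong (M (inject₁ (suc i))) (punchIn-inject₁ k c))))

setCol : ∀ {n} → Matrix n → Fin n → (Fin n → ℚ) → Matrix n
setCol M j col i k with k Fin.≟ j
... | yes _ = col i
... | no _ = M i k

setCol-same : ∀ {n} (M : Matrix n) j col i → setCol M j col i j ≡ col i
setCol-same M j col i with j Fin.≟ j
... | yes _ = refl
... | no j≢j = ⊥-elim (j≢j refl)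

setCol-other : ∀ {n} (M : Matrix n) j col i k → k ≢ j → setCol M j col i k ≡ M i k
setCol-other M j col i k k≢j with k Fin.≟ j
... | yes k≡j = ⊥-elim (k≢j k≡j)
... | no _ = refl

setCol-setCol : ∀ {n} (M : Matrix n) j col col′ i k → setCol (setCol M j col) j col′ i k ≡ setCol M j col′ i k
setCol-setCol M j col col′ i k with k Fin.≟ j
... | yes _ = refl
... | no k≢j = setCol-other M j col i k k≢j

spliceCols : ∀ {n} → ℕ → Matrix n → Matrix n → Matrix n
spliceCols s L R i j with toℕ j ℕ.<? s
... | yes _ = L i j
... | no _ = R i j

spliceCols-< : ∀ {n} s (L R : Matrix n) i j → toℕ j < s → spliceCols s L R i j ≡ L i j
spliceCols-< s L R i j j<s with toℕ j ℕ.<? s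
... | yes _ = refl
... | no j≮s = ⊥-elim (j≮s j<s)

spliceCols-≥ : ∀ {n} s (L R : Matrix n) i j → ¬ toℕ j < s → spliceCols s L R i j ≡ R i j
spliceCols-≥ s L R i j j≮s with toℕ j ℕ.<? s
... | yes j<s = ⊥-elim (j≮s j<s)
... | no _ = refl

suc≢inject₁ : ∀ {n} (t : Fin n) → suc t ≢ inject₁ t
suc≢inject₁ t eq = ℕₚ.1+n≢n (trans (cong toℕ eq) (Finₚ.toℕ-inject₁ t))

det-addNextCol : ∀ {n} (M M′ : Matrix (suc n)) (t : Fin n) (c : ℚ) →
                 (∀ i k → k ≢ inject₁ t → M′ i k ≡ M i k) →
                 (∀ i → M′ i (inject₁ t) ≡ M i (inject₁ t) + c * M i (suc t)) →
                 det M′ ≡ det M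
det-addNextCol M M′ t c M′≗M M′ₜ = begin
  det M′                   ≡⟨ det-linearCol M′ M M₂ p 1ℚ c (λ i k k≢p → M′≗M i k k≢p) M′≗M₂ M′ₚ ⟩
  1ℚ * det M + c * det M₂  ≡⟨ cong (λ d → 1ℚ * det M + c * d) M₂-singular ⟩
  1ℚ * det M + c * 0ℚ      ≡⟨ drop-zero (det M) c ⟩
  det M                    ∎
  where
  p = inject₁ t
  nextCol = λ i → M i (suc t)
  M₂ = setCol M p nextCol
  M′≗M₂ : ∀ i k → k ≢ p → M′ i k ≡ M₂ i k
  M′≗M₂ i k k≢p = trans (M′≗M i k k≢p) (sym (setCol-other M p nextCol i k k≢p))
  M′ₚ : ∀ i → M′ i p ≡ 1ℚ * M i p + c * M₂ i p
  M′ₚ i = trans (M′ₜ i) (cong₂ _+_ (sym (ℚₚ.*-identityˡ (M i p))) (cong (c *_) (sym (setCol-same M p nextCol i))))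
  M₂-singular : det M₂ ≡ 0ℚ
  M₂-singular = det-adjacentEqualCols M₂ p (suc t) (cong suc (sym (Finₚ.toℕ-inject₁ t)))
                  (λ i → trans (setCol-same M p nextCol i) (sym (setCol-other M p nextCol i (suc t) (suc≢inject₁ t))))
  drop-zero : ∀ d c → 1ℚ * d + c * 0ℚ ≡ d
  drop-zero = solve-∀ ℚ-ring

addNextCols : ∀ {n} → (Fin n → ℚ) → (Fin (suc n) → ℚ) → Fin (suc n) → ℚ
addNextCols {zero} c row zero = row zero
addNextCols {suc n} c row zero = row zero + c zero * row (suc zero)
addNextCols {suc n} c row (suc j) = addNextCols (c ∘ suc) (row ∘ suc) j

addNextCols-inject₁ : ∀ {n} c row (t : Fin n) → addNextCols c row (inject₁ t) ≡ row (inject₁ t) + c t * row (suc t)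
addNextCols-inject₁ {suc n} c row zero = refl
addNextCols-inject₁ {suc n} c row (suc t) = addNextCols-inject₁ (c ∘ suc) (row ∘ suc) t

addNextCols-fromℕ : ∀ {n} c row → addNextCols {n} c row (fromℕ n) ≡ row (fromℕ n)
addNextCols-fromℕ {zero} c row = refl
addNextCols-fromℕ {suc n} c row = addNextCols-fromℕ (c ∘ suc) (row ∘ suc)

-- Every column is changed by a multiple of the original next column; done from left to right, each step is
-- a single elementary column operation.
det-addNextCols : ∀ {n} (c : Fin n → ℚ) (M : Matrix (suc n)) → det (λ i → addNextCols c (M i)) ≡ det M
det-addNextCols {n} c M = trans (det-cong M′≗done) (partial n ℕₚ.≤-refl)
  where
  M′ : Matrix (suc n)
  M′ i = addNextCols c (M i)
  partial : ∀ s → s ≤ n → det (spliceCols s M′ M) ≡ det M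
  partial zero _ = det-cong (λ i j → spliceCols-≥ 0 M′ M i j (λ ()))
  partial (suc s) s<n = trans (det-addNextCol (spliceCols s M′ M) (spliceCols (suc s) M′ M) t (c t) same-elsewhere step)
                              (partial s (ℕₚ.<⇒≤ s<n))
    where
    t = fromℕ< s<n
    t≡s : toℕ (inject₁ t) ≡ s
    t≡s = trans (Finₚ.toℕ-inject₁ t) (Finₚ.toℕ-fromℕ< s<n)
    same-elsewhere : ∀ i k → k ≢ inject₁ t → spliceCols (suc s) M′ M i k ≡ spliceCols s M′ M i k
    same-elsewhere i k k≢t = byCases (toℕ k ℕ.<? s)
      where
      byCases : Dec (toℕ k < s) → spliceCols (suc s) M′ M i k ≡ spliceCols s M′ M i k
      byCases (yes k<s) = trans (spliceCols-< (suc s) M′ M i k (ℕₚ.m<n⇒m<1+n k<s)) (sym (spliceCols-< s M′ M i k k<s))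
      byCases (no k≮s) = trans (spliceCols-≥ (suc s) M′ M i k k≮1+s) (sym (spliceCols-≥ s M′ M i k k≮s))
        where
        k≮1+s : ¬ toℕ k < suc s
        k≮1+s k<1+s with ℕₚ.m<1+n⇒m<n∨m≡n k<1+s
        ... | inj₁ k<s = k≮s k<s
        ... | inj₂ k≡s = k≢t (Finₚ.toℕ-injective (trans k≡s (sym t≡s)))
    step : ∀ i → spliceCols (suc s) M′ M i (inject₁ t)
                 ≡ spliceCols s M′ M i (inject₁ t) + c t * spliceCols s M′ M i (suc t)
    step i = begin
      spliceCols (suc s) M′ M i (inject₁ t)    ≡⟨ spliceCols-< (suc s) M′ M i (inject₁ t) (s≤s (ℕₚ.≤-reflexive t≡s)) ⟩
      M′ i (inject₁ t)                        ≡⟨ addNextCols-inject₁ c (M i) t ⟩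
      M i (inject₁ t) + c t * M i (suc t)
        ≡⟨ cong₂ (λ a b → a + c t * b)
             (sym (spliceCols-≥ s M′ M i (inject₁ t) (ℕₚ.<-irrefl t≡s)))
             (sym (spliceCols-≥ s M′ M i (suc t)
                    (λ 1+t<s → ℕₚ.<-irrefl refl (ℕₚ.<-trans (s≤s (ℕₚ.≤-reflexive (sym t≡s′))) 1+t<s)))) ⟩
      spliceCols s M′ M i (inject₁ t) + c t * spliceCols s M′ M i (suc t) ∎
      where
      t≡s′ : toℕ t ≡ s
      t≡s′ = Finₚ.toℕ-fromℕ< s<n
  M′≗done : ∀ i j → M′ i j ≡ spliceCols n M′ M i j
  M′≗done i j = byCases (toℕ j ℕ.<? n)
    where
    byCases : Dec (toℕ j < n) → M′ i j ≡ spliceCols n M′ M i j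
    byCases (yes j<n) = sym (spliceCols-< n M′ M i j j<n)
    byCases (no j≮n) = begin
      M′ i j               ≡⟨ cong (M′ i) j≡last ⟩
      M′ i (fromℕ n)       ≡⟨ addNextCols-fromℕ c (M i) ⟩
      M i (fromℕ n)        ≡⟨ cong (M i) j≡last ⟨
      M i j                ≡⟨ spliceCols-≥ n M′ M i j j≮n ⟨
      spliceCols n M′ M i j ∎
      where
      j≡last : j ≡ fromℕ n
      j≡last = Finₚ.toℕ-injective
                 (trans (ℕₚ.≤-antisym (ℕₚ.≤-pred (Finₚ.toℕ<n j)) (ℕₚ.≮⇒≥ j≮n)) (sym (Finₚ.toℕ-fromℕ n)))

-- Sums over lists, multilinearity

sumOver : {A : Set} → List A → (A → ℚ) → ℚ
sumOver xs f = sumList (map f xs)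

infix 5 sumOver
syntax sumOver xs (λ x → e) = ∑[ x ← xs ] e

sumOver-cong : {A : Set} {f g : A → ℚ} (xs : List A) → (∀ x → x ∈ xs → f x ≡ g x) → sumOver xs f ≡ sumOver xs g
sumOver-cong [] f≗g = refl
sumOver-cong (x ∷ xs) f≗g = cong₂ _+_ (f≗g x (here refl)) (sumOver-cong xs (λ y y∈xs → f≗g y (there y∈xs)))

sumOver-++ : {A : Set} (xs ys : List A) (f : A → ℚ) → sumOver (xs ++ ys) f ≡ sumOver xs f + sumOver ys f
sumOver-++ [] ys f = sym (ℚₚ.+-identityˡ _)
sumOver-++ (x ∷ xs) ys f = trans (cong (f x +_) (sumOver-++ xs ys f)) (sym (ℚₚ.+-assoc (f x) (sumOver xs f) _))

sumOver-concatMap : {A B : Set} (g : A → List B) (xs : List A) (f : B → ℚ) →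
                    sumOver (concatMap g xs) f ≡ ∑[ x ← xs ] sumOver (g x) f
sumOver-concatMap g [] f = refl
sumOver-concatMap g (x ∷ xs) f = trans (sumOver-++ (g x) (concatMap g xs) f) (cong (sumOver (g x) f +_) (sumOver-concatMap g xs f))

sumOver-map : {A B : Set} (g : A → B) (xs : List A) (f : B → ℚ) → sumOver (map g xs) f ≡ sumOver xs (f ∘ g)
sumOver-map g [] f = refl
sumOver-map g (x ∷ xs) f = cong (f (g x) +_) (sumOver-map g xs f)

sumOver-*ˡ : {A : Set} (c : ℚ) (xs : List A) (f : A → ℚ) → c * sumOver xs f ≡ ∑[ x ← xs ] c * f x
sumOver-*ˡ c [] f = ℚₚ.*-zeroʳ c
sumOver-*ˡ c (x ∷ xs) f = trans (ℚₚ.*-distribˡ-+ c (f x) _) (cong (c * f x +_) (sumOver-*ˡ c xs f))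

det-sumCol : {A : Set} {n : ℕ} (M : Matrix n) (j : Fin n) (vs : List A) (α : A → ℚ) (P : A → Fin n → ℚ) →
             (∀ i → M i j ≡ ∑[ v ← vs ] α v * P v i) →
             det M ≡ ∑[ v ← vs ] α v * det (setCol M j (P v))
det-sumCol M j [] α P Mⱼ = begin
  det M                        ≡⟨ det-linearCol M M M j 0ℚ 0ℚ (λ _ _ _ → refl) (λ _ _ _ → refl) Mⱼ≡0+0 ⟩
  0ℚ * det M + 0ℚ * det M      ≡⟨ zeros (det M) ⟩
  0ℚ                           ∎
  where
  zeros : ∀ d → 0ℚ * d + 0ℚ * d ≡ 0ℚ
  zeros = solve-∀ ℚ-ring
  Mⱼ≡0+0 : ∀ i → M i j ≡ 0ℚ * M i j + 0ℚ * M i j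
  Mⱼ≡0+0 i = trans (Mⱼ i) (sym (zeros (M i j)))
det-sumCol M j (v ∷ vs) α P Mⱼ = begin
  det M
    ≡⟨ det-linearCol M (setCol M j (P v)) Mᵣ j (α v) 1ℚ
         (λ i k k≢j → sym (setCol-other M j (P v) i k k≢j)) (λ i k k≢j → sym (setCol-other M j rest i k k≢j)) split ⟩
  α v * det (setCol M j (P v)) + 1ℚ * det Mᵣ
    ≡⟨ cong (α v * det (setCol M j (P v)) +_) (ℚₚ.*-identityˡ (det Mᵣ)) ⟩
  α v * det (setCol M j (P v)) + det Mᵣ
    ≡⟨ cong (α v * det (setCol M j (P v)) +_) (det-sumCol Mᵣ j vs α P (setCol-same M j rest)) ⟩
  α v * det (setCol M j (P v)) + (∑[ w ← vs ] α w * det (setCol Mᵣ j (P w)))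
    ≡⟨ cong (α v * det (setCol M j (P v)) +_)
            (sumOver-cong vs (λ w _ → cong (α w *_) (det-cong (setCol-setCol M j rest (P w))))) ⟩
  ∑[ w ← v ∷ vs ] α w * det (setCol M j (P w)) ∎
  where
  rest : Fin _ → ℚ
  rest i = ∑[ w ← vs ] α w * P w i
  Mᵣ = setCol M j rest
  split : ∀ i → M i j ≡ α v * setCol M j (P v) i j + 1ℚ * Mᵣ i j
  split i = trans (Mⱼ i) (sym (cong₂ (λ a b → α v * a + b) (setCol-same M j (P v) i)
                                     (trans (ℚₚ.*-identityˡ (Mᵣ i j)) (setCol-same M j rest i))))

sequences : (ℕ → List ℕ) → ℕ → ℕ → List (List ℕ)
sequences vs t zero = [ [] ]
sequences vs t (suc k) = concatMap (λ v → map (v ∷_) (sequences vs (suc t) k)) (vs t)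

seqWeight : (ℕ → ℕ → ℚ) → ℕ → List ℕ → ℚ
seqWeight α t [] = 1ℚ
seqWeight α t (v ∷ μ) = α t v * seqWeight α (suc t) μ

sumOver-sequences : ∀ vs t k (F : List ℕ → ℚ) →
                    sumOver (sequences vs t (suc k)) F ≡ ∑[ v ← vs t ] ∑[ μ ← sequences vs (suc t) k ] F (v ∷ μ)
sumOver-sequences vs t k F =
  trans (sumOver-concatMap (λ v → map (v ∷_) (sequences vs (suc t) k)) (vs t) F)
        (sumOver-cong (vs t) (λ v _ → sumOver-map (v ∷_) (sequences vs (suc t) k) F))

∈-sequences-∷ : ∀ {vs t k μ} → μ ∈ sequences vs t (suc k) →
                Σ ℕ λ v → Σ (List ℕ) λ μ′ → v ∈ vs t × μ′ ∈ sequences vs (suc t) k × μ ≡ v ∷ μ′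
∈-sequences-∷ {vs} {t} {k} μ∈ with find (∈ₚ.∈-concatMap⁻ (λ v → map (v ∷_) (sequences vs (suc t) k)) {xs = vs t} μ∈)
... | v , v∈ , μ∈map with ∈ₚ.∈-map⁻ (v ∷_) μ∈map
... | μ′ , μ′∈ , refl = v , μ′ , v∈ , μ′∈ , refl

length-sequences : ∀ {vs t k μ} → μ ∈ sequences vs t k → length μ ≡ k
length-sequences {k = zero} (here refl) = refl
length-sequences {vs} {t} {suc k} μ∈ with ∈-sequences-∷ {vs} {t} {k} μ∈
... | v , μ′ , _ , μ′∈ , refl = cong suc (length-sequences {vs} {suc t} μ′∈)

part-++ˡ : ∀ (μ ν : List ℕ) k → k < length μ → part (μ ++ ν) k ≡ part μ k
part-++ˡ (a ∷ μ) ν zero _ = refl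
part-++ˡ (a ∷ μ) ν (suc k) (s≤s k<|μ|) = part-++ˡ μ ν k k<|μ|

part-++-length : ∀ (μ ν : List ℕ) v → part (μ ++ v ∷ ν) (length μ) ≡ v
part-++-length [] ν v = refl
part-++-length (a ∷ μ) ν v = part-++-length μ ν v

det-multilinear : ∀ {n} (M : Matrix n) (vs : ℕ → List ℕ) (α : ℕ → ℕ → ℚ) (P : ℕ → ℕ → Fin n → ℚ) →
                  (∀ i j → M i j ≡ ∑[ v ← vs (toℕ j) ] α (toℕ j) v * P (toℕ j) v i) →
                  det M ≡ ∑[ μ ← sequences vs 0 n ] seqWeight α 0 μ * det (λ i j → P (toℕ j) (part μ (toℕ j)) i)
det-multilinear {n} M vs α P M≗sum = begin
  det M
    ≡⟨ det-cong (λ i j → sym (spliceCols-≥ 0 (chosenCols []) M i j (λ ()))) ⟩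
  det (chosen [])
    ≡⟨ expand n 0 [] refl refl ⟩
  ∑[ μ ← sequences vs 0 n ] seqWeight α 0 μ * det (chosen μ)
    ≡⟨ sumOver-cong (sequences vs 0 n) (λ μ μ∈ → cong (seqWeight α 0 μ *_) (det-cong (λ i j →
         spliceCols-< (length μ) (chosenCols μ) M i j
           (ℕₚ.≤-trans (Finₚ.toℕ<n j) (ℕₚ.≤-reflexive (sym (length-sequences {vs} μ∈))))))) ⟩
  ∑[ μ ← sequences vs 0 n ] seqWeight α 0 μ * det (λ i j → P (toℕ j) (part μ (toℕ j)) i) ∎
  where
  chosenCols : List ℕ → Matrix n
  chosenCols pre i j = P (toℕ j) (part pre (toℕ j)) i
  chosen : List ℕ → Matrix n
  chosen pre = spliceCols (length pre) (chosenCols pre) M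
  regroup : ∀ a w d → a * (w * d) ≡ (a * w) * d
  regroup = solve-∀ ℚ-ring
  expand : ∀ k t pre → length pre ≡ t → t ℕ.+ k ≡ n →
           det (chosen pre) ≡ ∑[ μ ← sequences vs t k ] seqWeight α t μ * det (chosen (pre ++ μ))
  expand zero t pre _ _ =
    sym (trans (ℚₚ.+-identityʳ _) (trans (ℚₚ.*-identityˡ _) (cong (det ∘ chosen) (Listₚ.++-identityʳ pre))))
  expand (suc k) t pre |pre|≡t t+k≡n = begin
    det (chosen pre)
      ≡⟨ det-sumCol (chosen pre) j (vs t) (α t) (P t) column-j ⟩
    ∑[ v ← vs t ] α t v * det (setCol (chosen pre) j (P t v))
      ≡⟨ sumOver-cong (vs t) (λ v _ → cong (α t v *_) (det-cong (choose v))) ⟩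
    ∑[ v ← vs t ] α t v * det (chosen (pre ++ [ v ]))
      ≡⟨ sumOver-cong (vs t) (λ v _ → cong (α t v *_)
           (expand k (suc t) (pre ++ [ v ]) (|pre+v| v) (trans (sym (ℕₚ.+-suc t k)) t+k≡n))) ⟩
    ∑[ v ← vs t ] α t v * (∑[ μ ← sequences vs (suc t) k ] seqWeight α (suc t) μ * det (chosen ((pre ++ [ v ]) ++ μ)))
      ≡⟨ sumOver-cong (vs t) (λ v _ → trans (sumOver-*ˡ (α t v) (sequences vs (suc t) k) _)
           (sumOver-cong (sequences vs (suc t) k) (λ μ _ →
              trans (regroup (α t v) (seqWeight α (suc t) μ) _)
                    (cong (λ l → α t v * seqWeight α (suc t) μ * det (chosen l)) (Listₚ.++-assoc pre [ v ] μ))))) ⟩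
    ∑[ v ← vs t ] (∑[ μ ← sequences vs (suc t) k ] seqWeight α t (v ∷ μ) * det (chosen (pre ++ v ∷ μ)))
      ≡⟨ sumOver-sequences vs t k (λ μ → seqWeight α t μ * det (chosen (pre ++ μ))) ⟨
    ∑[ μ ← sequences vs t (suc k) ] seqWeight α t μ * det (chosen (pre ++ μ)) ∎
    where
    t<n : t < n
    t<n = ℕₚ.≤-trans (s≤s (ℕₚ.m≤m+n t k)) (ℕₚ.≤-reflexive (trans (sym (ℕₚ.+-suc t k)) t+k≡n))
    j : Fin n
    j = fromℕ< t<n
    j≡t : toℕ j ≡ t
    j≡t = Finₚ.toℕ-fromℕ< t<n
    column-j : ∀ i → chosen pre i j ≡ ∑[ v ← vs t ] α t v * P t v i
    column-j i = begin
      chosen pre i j   ≡⟨ spliceCols-≥ (length pre) (chosenCols pre) M i j (ℕₚ.<-irrefl (trans j≡t (sym |pre|≡t))) ⟩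
      M i j            ≡⟨ M≗sum i j ⟩
      ∑[ v ← vs (toℕ j) ] α (toℕ j) v * P (toℕ j) v i ≡⟨ cong (λ s → ∑[ v ← vs s ] α s v * P s v i) j≡t ⟩
      ∑[ v ← vs t ] α t v * P t v i ∎
    |pre+v| : ∀ v → length (pre ++ [ v ]) ≡ suc t
    |pre+v| v = trans (Listₚ.length-++ pre) (trans (cong (ℕ._+ 1) |pre|≡t) (ℕₚ.+-comm t 1))
    choose : ∀ v i c → setCol (chosen pre) j (P t v) i c ≡ chosen (pre ++ [ v ]) i c
    choose v i c with c Fin.≟ j
    ... | yes refl = sym (begin
      chosen (pre ++ [ v ]) i j
        ≡⟨ spliceCols-< (length (pre ++ [ v ])) (chosenCols (pre ++ [ v ])) M i j
             (ℕₚ.≤-reflexive (trans (cong suc j≡t) (sym (|pre+v| v)))) ⟩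
      P (toℕ j) (part (pre ++ [ v ]) (toℕ j)) i
        ≡⟨ cong₂ (λ s u → P s u i) j≡t (trans (cong (part (pre ++ [ v ])) (trans j≡t (sym |pre|≡t))) (part-++-length pre [] v)) ⟩
      P t v i ∎)
    ... | no c≢j = byCases (toℕ c ℕ.<? length pre)
      where
      byCases : Dec (toℕ c < length pre) → chosen pre i c ≡ chosen (pre ++ [ v ]) i c
      byCases (yes c<|pre|) =
        trans (spliceCols-< (length pre) (chosenCols pre) M i c c<|pre|)
              (sym (trans (spliceCols-< (length (pre ++ [ v ])) (chosenCols (pre ++ [ v ])) M i c
                             (ℕₚ.<-trans c<|pre| (ℕₚ.≤-reflexive (trans (cong suc |pre|≡t) (sym (|pre+v| v))))))
                          (cong (λ u → P (toℕ c) u i) (part-++ˡ pre [ v ] (toℕ c) c<|pre|))))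
      byCases (no c≮|pre|) =
        trans (spliceCols-≥ (length pre) (chosenCols pre) M i c c≮|pre|)
              (sym (spliceCols-≥ (length (pre ++ [ v ])) (chosenCols (pre ++ [ v ])) M i c c≮|pre+v|))
        where
        c≮|pre+v| : ¬ toℕ c < length (pre ++ [ v ])
        c≮|pre+v| c< with ℕₚ.m<1+n⇒m<n∨m≡n (ℕₚ.≤-trans c< (ℕₚ.≤-reflexive (trans (|pre+v| v) (cong suc (sym |pre|≡t)))))
        ... | inj₁ c<|pre| = c≮|pre| c<|pre|
        ... | inj₂ c≡|pre| = c≢j (Finₚ.toℕ-injective (trans c≡|pre| (trans |pre|≡t (sym j≡t))))

-- Antisymmetrised powers

inv-inverseʳ : ∀ y → y ≢ 0ℚ → y * inv y ≡ 1ℚ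
inv-inverseʳ y y≢0 with y ℚₚ.≟ 0ℚ
... | yes y≡0 = ⊥-elim (y≢0 y≡0)
... | no y≢0′ = ℚₚ.*-inverseʳ y {{≢-nonZero y≢0′}}

pow-+ : ∀ x a b → pow x (a ℕ.+ b) ≡ pow x a * pow x b
pow-+ x zero b = sym (ℚₚ.*-identityˡ (pow x b))
pow-+ x (suc a) b = trans (cong (x *_) (pow-+ x a b)) (sym (ℚₚ.*-assoc x (pow x a) (pow x b)))

asym : ℚ → ℕ → ℚ
asym y m = pow y m - pow (inv y) m

oddAsym : ℚ → ℕ → ℚ → ℚ
oddAsym z l y = asym y (suc l) - inv z * asym y l

pairGap : ℚ → ℚ → ℚ
pairGap z y = (y + inv y) - (z + inv z)

dif-asym : ∀ y m → dif y (ℤ.+ m) ≡ asym y m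
dif-asym y zero = refl
dif-asym y (suc m) = refl

-- Each identity below is a ring identity up to a multiple of 1 - u * inv u, which vanishes.
asym-recurrence : ∀ y m → y ≢ 0ℚ → asym y (suc (suc m)) + asym y m ≡ (y + inv y) * asym y (suc m)
asym-recurrence y m y≢0 = begin
  asym y (suc (suc m)) + asym y m
    ≡⟨ expand y (inv y) (pow y m) (pow (inv y) m) ⟩
  (y + inv y) * asym y (suc m) + (1ℚ - y * inv y) * asym y m
    ≡⟨ cong (λ e → (y + inv y) * asym y (suc m) + (1ℚ - e) * asym y m) (inv-inverseʳ y y≢0) ⟩
  (y + inv y) * asym y (suc m) + (1ℚ - 1ℚ) * asym y m
    ≡⟨ drop (((y + inv y) * asym y (suc m))) (asym y m) ⟩
  (y + inv y) * asym y (suc m) ∎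
  where
  expand : ∀ u ui p q → (u * (u * p) - ui * (ui * q)) + (p - q) ≡ (u + ui) * (u * p - ui * q) + (1ℚ - u * ui) * (p - q)
  expand = solve-∀ ℚ-ring
  drop : ∀ a b → a + (1ℚ - 1ℚ) * b ≡ a
  drop = solve-∀ ℚ-ring

oddAsym-recurrence : ∀ z y m → z ≢ 0ℚ → y ≢ 0ℚ → oddAsym z (suc m) y - z * oddAsym z m y ≡ pairGap z y * asym y (suc m)
oddAsym-recurrence z y m z≢0 y≢0 = begin
  oddAsym z (suc m) y - z * oddAsym z m y
    ≡⟨ expand (asym y (suc (suc m))) (asym y (suc m)) (asym y m) z (inv z) ⟩
  (asym y (suc (suc m)) + asym y m) - (z + inv z) * asym y (suc m) - (1ℚ - z * inv z) * asym y m
    ≡⟨ cong₂ (λ a e → a - (z + inv z) * asym y (suc m) - (1ℚ - e) * asym y m)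
             (asym-recurrence y m y≢0) (inv-inverseʳ z z≢0) ⟩
  (y + inv y) * asym y (suc m) - (z + inv z) * asym y (suc m) - (1ℚ - 1ℚ) * asym y m
    ≡⟨ collect (y + inv y) (z + inv z) (asym y (suc m)) (asym y m) ⟩
  pairGap z y * asym y (suc m) ∎
  where
  expand : ∀ a₂ a₁ a₀ u ui → (a₂ - ui * a₁) - u * (a₁ - ui * a₀) ≡ (a₂ + a₀) - (u + ui) * a₁ - (1ℚ - u * ui) * a₀
  expand = solve-∀ ℚ-ring
  collect : ∀ Y Z a₁ a₀ → Y * a₁ - Z * a₁ - (1ℚ - 1ℚ) * a₀ ≡ (Y - Z) * a₁
  collect = solve-∀ ℚ-ring

oddAsym-diagonal : ∀ z l → oddAsym z l z ≡ pow z l * (z - inv z)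
oddAsym-diagonal z l = factor z (inv z) (pow z l) (pow (inv z) l)
  where
  factor : ∀ u ui p q → (u * p - ui * q) - ui * (p - q) ≡ p * (u - ui)
  factor = solve-∀ ℚ-ring

interval : ℕ → ℕ → List ℕ
interval lo zero = [ lo ]
interval lo (suc d) = lo ∷ interval (suc lo) d

suc-+-∸ : ∀ lo k → suc (lo ℕ.+ k) ∸ lo ≡ suc k
suc-+-∸ lo k = trans (cong (_∸ lo) (sym (ℕₚ.+-suc lo k))) (ℕₚ.m+n∸m≡n lo (suc k))

oddAsym-telescope : ∀ z y → z ≢ 0ℚ → y ≢ 0ℚ → ∀ lo k o →
  oddAsym z (lo ℕ.+ k ℕ.+ suc o) y - pow z (suc k) * oddAsym z (lo ℕ.+ o) y
    ≡ pairGap z y * (∑[ v ← interval lo k ] pow z (lo ℕ.+ k ∸ v) * asym y (v ℕ.+ suc o))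
oddAsym-telescope z y z≢0 y≢0 lo zero o rewrite ℕₚ.+-identityʳ lo | ℕₚ.n∸n≡0 lo | ℕₚ.+-suc lo o = begin
  oddAsym z (suc (lo ℕ.+ o)) y - z * 1ℚ * oddAsym z (lo ℕ.+ o) y
    ≡⟨ cong (λ c → oddAsym z (suc (lo ℕ.+ o)) y - c * oddAsym z (lo ℕ.+ o) y) (ℚₚ.*-identityʳ z) ⟩
  oddAsym z (suc (lo ℕ.+ o)) y - z * oddAsym z (lo ℕ.+ o) y
    ≡⟨ oddAsym-recurrence z y (lo ℕ.+ o) z≢0 y≢0 ⟩
  pairGap z y * asym y (suc (lo ℕ.+ o))
    ≡⟨ cong (pairGap z y *_) (sym (trans (ℚₚ.+-identityʳ _) (ℚₚ.*-identityˡ _))) ⟩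
  pairGap z y * (1ℚ * asym y (suc (lo ℕ.+ o)) + 0ℚ) ∎
oddAsym-telescope z y z≢0 y≢0 lo (suc k) o rewrite ℕₚ.+-suc lo k | suc-+-∸ lo k | ℕₚ.+-suc lo o = begin
  oddAsym z (suc (lo ℕ.+ k ℕ.+ suc o)) y - z * zᵏ⁺¹ * oddAsym z (lo ℕ.+ o) y
    ≡⟨ split (oddAsym z (suc (lo ℕ.+ k ℕ.+ suc o)) y) (oddAsym z (suc (lo ℕ.+ o)) y) (oddAsym z (lo ℕ.+ o) y) zᵏ⁺¹ z ⟩
  (oddAsym z (suc lo ℕ.+ k ℕ.+ suc o) y - zᵏ⁺¹ * oddAsym z (suc lo ℕ.+ o) y)
    + zᵏ⁺¹ * (oddAsym z (suc (lo ℕ.+ o)) y - z * oddAsym z (lo ℕ.+ o) y)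
    ≡⟨ cong₂ (λ a b → a + zᵏ⁺¹ * b) (oddAsym-telescope z y z≢0 y≢0 (suc lo) k o)
                                     (oddAsym-recurrence z y (lo ℕ.+ o) z≢0 y≢0) ⟩
  pairGap z y * rest + zᵏ⁺¹ * (pairGap z y * asym y (suc (lo ℕ.+ o)))
    ≡⟨ factor (pairGap z y) rest zᵏ⁺¹ (asym y (suc (lo ℕ.+ o))) ⟩
  pairGap z y * (zᵏ⁺¹ * asym y (suc (lo ℕ.+ o)) + rest) ∎
  where
  zᵏ⁺¹ = pow z (suc k)
  rest = ∑[ v ← interval (suc lo) k ] pow z (suc (lo ℕ.+ k) ∸ v) * asym y (v ℕ.+ suc o)
  split : ∀ A B C p u → A - u * p * C ≡ (A - p * B) + p * (B - u * C)
  split = solve-∀ ℚ-ring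
  factor : ∀ K S p d → K * S + p * (K * d) ≡ K * (p * d + S)
  factor = solve-∀ ℚ-ring

oddAsym-telescope-inv : ∀ w y lo k o →
  ∑[ v ← interval lo k ] pow (inv w) (lo ℕ.+ k ∸ v) * oddAsym w (v ℕ.+ o) y
    ≡ asym y (lo ℕ.+ k ℕ.+ suc o) - pow (inv w) (suc k) * asym y (lo ℕ.+ o)
oddAsym-telescope-inv w y lo zero o rewrite ℕₚ.+-identityʳ lo | ℕₚ.n∸n≡0 lo | ℕₚ.+-suc lo o =
  base (asym y (suc (lo ℕ.+ o))) (asym y (lo ℕ.+ o)) (inv w)
  where
  base : ∀ a b iw → 1ℚ * (a - iw * b) + 0ℚ ≡ a - iw * 1ℚ * b
  base = solve-∀ ℚ-ring
oddAsym-telescope-inv w y lo (suc k) o rewrite ℕₚ.+-suc lo k | suc-+-∸ lo k = begin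
  iwᵏ⁺¹ * oddAsym w (lo ℕ.+ o) y + (∑[ v ← interval (suc lo) k ] pow (inv w) (suc (lo ℕ.+ k) ∸ v) * oddAsym w (v ℕ.+ o) y)
    ≡⟨ cong (iwᵏ⁺¹ * oddAsym w (lo ℕ.+ o) y +_) (oddAsym-telescope-inv w y (suc lo) k o) ⟩
  iwᵏ⁺¹ * oddAsym w (lo ℕ.+ o) y + (asym y (suc lo ℕ.+ k ℕ.+ suc o) - iwᵏ⁺¹ * asym y (suc lo ℕ.+ o))
    ≡⟨ telescope iwᵏ⁺¹ (asym y (suc (lo ℕ.+ o))) (asym y (lo ℕ.+ o)) (inv w) (asym y (suc (lo ℕ.+ k ℕ.+ suc o))) ⟩
  asym y (suc (lo ℕ.+ k ℕ.+ suc o)) - inv w * iwᵏ⁺¹ * asym y (lo ℕ.+ o) ∎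
  where
  iwᵏ⁺¹ = pow (inv w) (suc k)
  telescope : ∀ p a₁ a₀ iw aₜ → p * (a₁ - iw * a₀) + (aₜ - p * a₁) ≡ aₜ - iw * p * a₀
  telescope = solve-∀ ℚ-ring

-- Branching rules

betweenParts : List ℕ → ℕ → List ℕ
betweenParts la s = interval (part la (suc s)) (part la s ∸ part la (suc s))

interlacing : List ℕ → ℕ → List (List ℕ)
interlacing la k = sequences (betweenParts la) 0 k

powGap : ℚ → List ℕ → ℕ → ℕ → ℚ
powGap c la s v = pow c (part la s ∸ v)

oddMatrix : (n : ℕ) → List ℕ → (Fin (suc n) → ℚ) → Matrix (suc n)
oddMatrix n la x i j = oddAsym (zOf x) (part la (toℕ j) ℕ.+ (n ∸ toℕ j)) (x i)

-- The numerator matrix of the symplectic character sp_μ(y^±); for μ = ∅ it is the denominator (bᵢⱼ).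
evenMatrix : (n : ℕ) → List ℕ → (Fin n → ℚ) → Matrix n
evenMatrix n μ y i j = asym (y i) (part μ (toℕ j) ℕ.+ (n ∸ toℕ j))

-- Adding -z^(λⱼ - λⱼ₊₁ + 1) times the next column empties the row of z (oddAsym-diagonal) and telescopes the others.
det-oddMatrix-branch :
  ∀ n top (x : Fin (suc n) → ℚ) → (∀ i → x i ≢ 0ℚ) → IsPartition top →
  det (oddMatrix n top x)
    ≡ oddAsym (zOf x) (part top n) (zOf x)
      * (prodFin (λ i → pairGap (zOf x) (x (inject₁ i)))
         * (∑[ μ ← interlacing top n ] seqWeight (powGap (zOf x) top) 0 μ * det (evenMatrix n μ (x ∘ inject₁))))
det-oddMatrix-branch n top x x≢0 top-partition = begin
  det (oddMatrix n top x)
    ≡⟨ det-addNextCols c (oddMatrix n top x) ⟨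
  det H
    ≡⟨ det-lastRow H lastRow≡0 ⟩
  H (fromℕ n) (fromℕ n) * det (λ i j → H (inject₁ i) (inject₁ j))
    ≡⟨ cong₂ _*_ corner (det-cong inner) ⟩
  oddAsym z (part top n) z * det (λ i j → pairGap z (x (inject₁ i)) * N i j)
    ≡⟨ cong (oddAsym z (part top n) z *_) (det-scaleRows (λ i → pairGap z (x (inject₁ i))) N) ⟩
  oddAsym z (part top n) z * (prodFin (λ i → pairGap z (x (inject₁ i))) * det N)
    ≡⟨ cong (λ d → oddAsym z (part top n) z * (prodFin (λ i → pairGap z (x (inject₁ i))) * d))
            (det-multilinear N (betweenParts top) (powGap z top) P (λ i j → refl)) ⟩
  oddAsym z (part top n) z
    * (prodFin (λ i → pairGap z (x (inject₁ i)))
       * (∑[ μ ← interlacing top n ] seqWeight (powGap z top) 0 μ * det (evenMatrix n μ (x ∘ inject₁)))) ∎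
  where
  z = zOf x
  lo hi gap o : Fin n → ℕ
  lo t = part top (suc (toℕ t))
  hi t = part top (toℕ t)
  gap t = hi t ∸ lo t
  o t = n ∸ suc (toℕ t)
  c : Fin n → ℚ
  c t = - pow z (suc (gap t))
  H : Matrix (suc n)
  H i = addNextCols c (oddMatrix n top x i)
  column-exponent : ∀ t → part top (toℕ (inject₁ t)) ℕ.+ (n ∸ toℕ (inject₁ t)) ≡ lo t ℕ.+ gap t ℕ.+ suc (o t)
  column-exponent t = begin
    part top (toℕ (inject₁ t)) ℕ.+ (n ∸ toℕ (inject₁ t)) ≡⟨ cong (λ s → part top s ℕ.+ (n ∸ s)) (Finₚ.toℕ-inject₁ t) ⟩
    hi t ℕ.+ (n ∸ toℕ t)
      ≡⟨ cong₂ ℕ._+_ (ℕₚ.m+[n∸m]≡n (top-partition (toℕ t))) (sym (ℕₚ.+-∸-assoc 1 (Finₚ.toℕ<n t))) ⟨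
    lo t ℕ.+ gap t ℕ.+ suc (o t)                           ∎
  H-entry : ∀ i t → H i (inject₁ t)
                    ≡ oddAsym z (lo t ℕ.+ gap t ℕ.+ suc (o t)) (x i) - pow z (suc (gap t)) * oddAsym z (lo t ℕ.+ o t) (x i)
  H-entry i t = begin
    H i (inject₁ t)
      ≡⟨ addNextCols-inject₁ c (oddMatrix n top x i) t ⟩
    oddMatrix n top x i (inject₁ t) + c t * oddMatrix n top x i (suc t)
      ≡⟨ cong (λ m → oddAsym z m (x i) + c t * oddMatrix n top x i (suc t)) (column-exponent t) ⟩
    oddAsym z (lo t ℕ.+ gap t ℕ.+ suc (o t)) (x i) + c t * oddAsym z (lo t ℕ.+ o t) (x i)
      ≡⟨ cong (oddAsym z (lo t ℕ.+ gap t ℕ.+ suc (o t)) (x i) +_)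
              (ℚₚ.neg-distribˡ-* (pow z (suc (gap t))) (oddAsym z (lo t ℕ.+ o t) (x i))) ⟨
    oddAsym z (lo t ℕ.+ gap t ℕ.+ suc (o t)) (x i) - pow z (suc (gap t)) * oddAsym z (lo t ℕ.+ o t) (x i) ∎
  lastRow≡0 : ∀ t → H (fromℕ n) (inject₁ t) ≡ 0ℚ
  lastRow≡0 t = begin
    H (fromℕ n) (inject₁ t)
      ≡⟨ H-entry (fromℕ n) t ⟩
    oddAsym z (lo t ℕ.+ gap t ℕ.+ suc (o t)) z - pow z (suc (gap t)) * oddAsym z (lo t ℕ.+ o t) z
      ≡⟨ cong₂ (λ a b → a - pow z (suc (gap t)) * b)
               (oddAsym-diagonal z (lo t ℕ.+ gap t ℕ.+ suc (o t))) (oddAsym-diagonal z (lo t ℕ.+ o t)) ⟩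
    pow z (lo t ℕ.+ gap t ℕ.+ suc (o t)) * (z - inv z) - pow z (suc (gap t)) * (pow z (lo t ℕ.+ o t) * (z - inv z))
      ≡⟨ cong (λ p → p * (z - inv z) - pow z (suc (gap t)) * (pow z (lo t ℕ.+ o t) * (z - inv z)))
              (trans (cong (pow z) (exponent (lo t) (gap t) (o t))) (pow-+ z (suc (gap t)) (lo t ℕ.+ o t))) ⟩
    pow z (suc (gap t)) * pow z (lo t ℕ.+ o t) * (z - inv z) - pow z (suc (gap t)) * (pow z (lo t ℕ.+ o t) * (z - inv z))
      ≡⟨ cancel (pow z (suc (gap t))) (pow z (lo t ℕ.+ o t)) (z - inv z) ⟩
    0ℚ ∎
    where
    exponent : ∀ l k m → l ℕ.+ k ℕ.+ suc m ≡ suc k ℕ.+ (l ℕ.+ m)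
    exponent = ℕ-Solver.solve-∀
    cancel : ∀ p q e → p * q * e - p * (q * e) ≡ 0ℚ
    cancel = solve-∀ ℚ-ring
  corner : H (fromℕ n) (fromℕ n) ≡ oddAsym z (part top n) z
  corner = trans (addNextCols-fromℕ c (oddMatrix n top x (fromℕ n)))
                 (cong (λ m → oddAsym z m z) (begin
                    part top (toℕ (fromℕ n)) ℕ.+ (n ∸ toℕ (fromℕ n)) ≡⟨ cong (λ s → part top s ℕ.+ (n ∸ s)) (Finₚ.toℕ-fromℕ n) ⟩
                    part top n ℕ.+ (n ∸ n)                           ≡⟨ cong (part top n ℕ.+_) (ℕₚ.n∸n≡0 n) ⟩
                    part top n ℕ.+ 0                                 ≡⟨ ℕₚ.+-identityʳ _ ⟩
                    part top n                                       ∎))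
  P : ℕ → ℕ → Fin n → ℚ
  P s v i = asym (x (inject₁ i)) (v ℕ.+ (n ∸ s))
  N : Matrix n
  N i j = ∑[ v ← betweenParts top (toℕ j) ] powGap z top (toℕ j) v * P (toℕ j) v i
  inner : ∀ i j → H (inject₁ i) (inject₁ j) ≡ pairGap z (x (inject₁ i)) * N i j
  inner i j = begin
    H (inject₁ i) (inject₁ j)
      ≡⟨ H-entry (inject₁ i) j ⟩
    oddAsym z (lo j ℕ.+ gap j ℕ.+ suc (o j)) (x (inject₁ i)) - pow z (suc (gap j)) * oddAsym z (lo j ℕ.+ o j) (x (inject₁ i))
      ≡⟨ oddAsym-telescope z (x (inject₁ i)) (x≢0 (fromℕ n)) (x≢0 (inject₁ i)) (lo j) (gap j) (o j) ⟩
    pairGap z (x (inject₁ i)) * (∑[ v ← interval (lo j) (gap j) ] pow z (lo j ℕ.+ gap j ∸ v) * asym (x (inject₁ i)) (v ℕ.+ suc (o j)))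
      ≡⟨ cong₂ (λ h e → pairGap z (x (inject₁ i)) * (∑[ v ← interval (lo j) (gap j) ] pow z (h ∸ v) * asym (x (inject₁ i)) (v ℕ.+ e)))
               (ℕₚ.m+[n∸m]≡n (top-partition (toℕ j))) (sym (ℕₚ.+-∸-assoc 1 (Finₚ.toℕ<n j))) ⟩
    pairGap z (x (inject₁ i)) * N i j ∎

data InjectOrLast : ∀ {n} → Fin (suc n) → Set where
  injected : ∀ {n} (t : Fin n) → InjectOrLast (inject₁ t)
  last : ∀ {n} → InjectOrLast (fromℕ n)

injectOrLast : ∀ {n} (j : Fin (suc n)) → InjectOrLast j
injectOrLast {zero} zero = last
injectOrLast {suc n} zero = injected zero
injectOrLast {suc n} (suc j) with injectOrLast j
... | injected t = injected (suc t)
... | last = last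

det-evenMatrix-branch :
  ∀ n μ (y : Fin (suc n) → ℚ) → IsPartition μ → part μ (suc n) ≡ 0 →
  det (evenMatrix (suc n) μ y)
    ≡ ∑[ ρ ← interlacing μ (suc n) ] seqWeight (powGap (inv (zOf y)) μ) 0 ρ * det (oddMatrix n ρ y)
det-evenMatrix-branch n μ y μ-partition μₙ₊₁≡0 = begin
  det (evenMatrix (suc n) μ y)
    ≡⟨ det-addNextCols c (evenMatrix (suc n) μ y) ⟨
  det (λ i → addNextCols c (evenMatrix (suc n) μ y i))
    ≡⟨ det-cong (λ i j → entry i j (injectOrLast j)) ⟩
  det N
    ≡⟨ det-multilinear N (betweenParts μ) (powGap iw μ) P (λ i j → refl) ⟩
  ∑[ ρ ← interlacing μ (suc n) ] seqWeight (powGap iw μ) 0 ρ * det (oddMatrix n ρ y) ∎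
  where
  w = zOf y
  iw = inv w
  lo hi gap o : Fin n → ℕ
  lo t = part μ (suc (toℕ t))
  hi t = part μ (toℕ t)
  gap t = hi t ∸ lo t
  o t = n ∸ toℕ t
  c : Fin n → ℚ
  c t = - pow iw (suc (gap t))
  P : ℕ → ℕ → Fin (suc n) → ℚ
  P s v i = oddAsym w (v ℕ.+ (n ∸ s)) (y i)
  N : Matrix (suc n)
  N i j = ∑[ v ← betweenParts μ (toℕ j) ] powGap iw μ (toℕ j) v * P (toℕ j) v i
  entry : ∀ i j → InjectOrLast j → addNextCols c (evenMatrix (suc n) μ y i) j ≡ N i j
  entry i .(inject₁ t) (injected t) = begin
    addNextCols c (evenMatrix (suc n) μ y i) (inject₁ t)
      ≡⟨ addNextCols-inject₁ c (evenMatrix (suc n) μ y i) t ⟩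
    asym (y i) (part μ (toℕ (inject₁ t)) ℕ.+ (suc n ∸ toℕ (inject₁ t))) + c t * asym (y i) (lo t ℕ.+ o t)
      ≡⟨ cong₂ (λ m d → asym (y i) m + d) exponent (sym (ℚₚ.neg-distribˡ-* (pow iw (suc (gap t))) _)) ⟩
    asym (y i) (lo t ℕ.+ gap t ℕ.+ suc (o t)) - pow iw (suc (gap t)) * asym (y i) (lo t ℕ.+ o t)
      ≡⟨ oddAsym-telescope-inv w (y i) (lo t) (gap t) (o t) ⟨
    ∑[ v ← interval (lo t) (gap t) ] pow iw (lo t ℕ.+ gap t ∸ v) * oddAsym w (v ℕ.+ o t) (y i)
      ≡⟨ cong (λ h → ∑[ v ← interval (lo t) (gap t) ] pow iw (h ∸ v) * oddAsym w (v ℕ.+ o t) (y i))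
              (ℕₚ.m+[n∸m]≡n (μ-partition (toℕ t))) ⟩
    ∑[ v ← betweenParts μ (toℕ t) ] powGap iw μ (toℕ t) v * P (toℕ t) v i
      ≡⟨ cong (λ s → ∑[ v ← betweenParts μ s ] powGap iw μ s v * P s v i) (Finₚ.toℕ-inject₁ t) ⟨
    N i (inject₁ t) ∎
    where
    exponent : part μ (toℕ (inject₁ t)) ℕ.+ (suc n ∸ toℕ (inject₁ t)) ≡ lo t ℕ.+ gap t ℕ.+ suc (o t)
    exponent = begin
      part μ (toℕ (inject₁ t)) ℕ.+ (suc n ∸ toℕ (inject₁ t)) ≡⟨ cong (λ s → part μ s ℕ.+ (suc n ∸ s)) (Finₚ.toℕ-inject₁ t) ⟩
      hi t ℕ.+ (suc n ∸ toℕ t)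
        ≡⟨ cong₂ ℕ._+_ (ℕₚ.m+[n∸m]≡n (μ-partition (toℕ t))) (sym (ℕₚ.+-∸-assoc 1 (ℕₚ.<⇒≤ (Finₚ.toℕ<n t)))) ⟨
      lo t ℕ.+ gap t ℕ.+ suc (o t)                            ∎
  entry i .(fromℕ n) last = begin
    addNextCols c (evenMatrix (suc n) μ y i) (fromℕ n)
      ≡⟨ addNextCols-fromℕ c (evenMatrix (suc n) μ y i) ⟩
    asym (y i) (part μ (toℕ (fromℕ n)) ℕ.+ (suc n ∸ toℕ (fromℕ n)))
      ≡⟨ cong (λ s → asym (y i) (part μ s ℕ.+ (suc n ∸ s))) (Finₚ.toℕ-fromℕ n) ⟩
    asym (y i) (part μ n ℕ.+ (suc n ∸ n))
      ≡⟨ cong (λ m → asym (y i) (part μ n ℕ.+ m)) (trans (ℕₚ.+-∸-assoc 1 {n} ℕₚ.≤-refl) (cong suc (ℕₚ.n∸n≡0 n))) ⟩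
    asym (y i) (part μ n ℕ.+ 1)
      ≡⟨ asym-0 (asym (y i) (part μ n ℕ.+ 1)) (pow iw (suc (part μ n))) ⟨
    asym (y i) (part μ n ℕ.+ 1) - pow iw (suc (part μ n)) * (1ℚ - 1ℚ)
      ≡⟨ oddAsym-telescope-inv w (y i) 0 (part μ n) 0 ⟨
    ∑[ v ← interval 0 (part μ n) ] pow iw (part μ n ∸ v) * oddAsym w (v ℕ.+ 0) (y i)
      ≡⟨ cong₂ (λ l e → ∑[ v ← interval l (part μ n ∸ l) ] pow iw (part μ n ∸ v) * oddAsym w (v ℕ.+ e) (y i))
               (sym μₙ₊₁≡0) (sym (ℕₚ.n∸n≡0 n)) ⟩
    ∑[ v ← betweenParts μ n ] powGap iw μ n v * P n v i
      ≡⟨ cong (λ s → ∑[ v ← betweenParts μ s ] powGap iw μ s v * P s v i) (Finₚ.toℕ-fromℕ n) ⟨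
    N i (fromℕ n) ∎
    where
    asym-0 : ∀ a p → a - p * (1ℚ - 1ℚ) ≡ a
    asym-0 = solve-∀ ℚ-ring

-- Interlacing sequences

∈-interval⁻ : ∀ lo d v → v ∈ interval lo d → lo ≤ v × v ≤ lo ℕ.+ d
∈-interval⁻ lo zero v (here refl) = ℕₚ.≤-refl , ℕₚ.m≤m+n lo 0
∈-interval⁻ lo (suc d) v (here refl) = ℕₚ.≤-refl , ℕₚ.m≤m+n lo (suc d)
∈-interval⁻ lo (suc d) v (there v∈) with ∈-interval⁻ (suc lo) d v v∈
... | lo<v , v≤ = ℕₚ.<⇒≤ lo<v , ℕₚ.≤-trans v≤ (ℕₚ.≤-reflexive (sym (ℕₚ.+-suc lo d)))

∈-interval⁺ : ∀ lo d v → lo ≤ v → v ≤ lo ℕ.+ d → v ∈ interval lo d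
∈-interval⁺ lo zero v lo≤v v≤ = here (ℕₚ.≤-antisym (ℕₚ.≤-trans v≤ (ℕₚ.≤-reflexive (ℕₚ.+-identityʳ lo))) lo≤v)
∈-interval⁺ lo (suc d) v lo≤v v≤ with ℕₚ.m≤n⇒m<n∨m≡n lo≤v
... | inj₂ lo≡v = here (sym lo≡v)
... | inj₁ lo<v = there (∈-interval⁺ (suc lo) d v lo<v (ℕₚ.≤-trans v≤ (ℕₚ.≤-reflexive (ℕₚ.+-suc lo d))))

all-∈ : {A : Set} {P : A → Set} (xs : List A) → (∀ x → x ∈ xs → P x) → All P xs
all-∈ [] f = All.[]
all-∈ (x ∷ xs) f = f x (here refl) All.∷ all-∈ xs (λ y y∈ → f y (there y∈))

interval-unique : ∀ lo d → Unique (interval lo d)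
interval-unique lo zero = All.[] ∷ []
interval-unique lo (suc d) =
  all-∈ (interval (suc lo) d) (λ v v∈ lo≡v → ℕₚ.<-irrefl lo≡v (proj₁ (∈-interval⁻ (suc lo) d v v∈)))
  ∷ interval-unique (suc lo) d

concatMap-unique : {A B : Set} (f : A → List B) (key : B → A) (xs : List A) →
                   (∀ a b → b ∈ f a → key b ≡ a) → Unique xs → (∀ a → a ∈ xs → Unique (f a)) →
                   Unique (concatMap f xs)
concatMap-unique f key [] _ _ _ = []
concatMap-unique f key (a ∷ xs) key-f (a∉xs ∷ xs-unique) f-unique =
  Uniqueₚ.++⁺ (f-unique a (here refl)) (concatMap-unique f key xs key-f xs-unique (λ a′ a′∈ → f-unique a′ (there a′∈))) disjoint
  where
  disjoint : ∀ {b} → b ∈ f a × b ∈ concatMap f xs → ⊥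
  disjoint {b} (b∈fa , b∈rest) with find (∈ₚ.∈-concatMap⁻ f {xs = xs} b∈rest)
  ... | a′ , a′∈xs , b∈fa′ = All.lookup a∉xs a′∈xs (trans (sym (key-f a b b∈fa)) (key-f a′ b b∈fa′))

head₀ : List ℕ → ℕ
head₀ [] = 0
head₀ (v ∷ _) = v

sequences-unique : ∀ vs t k → (∀ s → Unique (vs s)) → Unique (sequences vs t k)
sequences-unique vs t zero _ = All.[] ∷ []
sequences-unique vs t (suc k) vs-unique =
  concatMap-unique (λ v → map (v ∷_) (sequences vs (suc t) k)) head₀ (vs t) head-∷ (vs-unique t)
    (λ v _ → Uniqueₚ.map⁺ Listₚ.∷-injectiveʳ (sequences-unique vs (suc t) k vs-unique))
  where
  head-∷ : ∀ v μ → μ ∈ map (v ∷_) (sequences vs (suc t) k) → head₀ μ ≡ v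
  head-∷ v μ μ∈ with ∈ₚ.∈-map⁻ (v ∷_) μ∈
  ... | _ , _ , refl = refl

∈-sequences⁻ : ∀ {vs t k μ} → μ ∈ sequences vs t k → ∀ i → i < k → part μ i ∈ vs (t ℕ.+ i)
∈-sequences⁻ {vs} {t} {suc k} μ∈ i i<k with ∈-sequences-∷ {vs} {t} {k} μ∈
∈-sequences⁻ {vs} {t} {suc k} μ∈ zero _ | v , μ′ , v∈ , _ , refl = subst (λ s → v ∈ vs s) (sym (ℕₚ.+-identityʳ t)) v∈
∈-sequences⁻ {vs} {t} {suc k} μ∈ (suc i) (s≤s i<k) | v , μ′ , _ , μ′∈ , refl =
  subst (λ s → part μ′ i ∈ vs s) (sym (ℕₚ.+-suc t i)) (∈-sequences⁻ {vs} {suc t} μ′∈ i i<k)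

∈-sequences⁺ : ∀ vs t k μ → length μ ≡ k → (∀ i → i < k → part μ i ∈ vs (t ℕ.+ i)) → μ ∈ sequences vs t k
∈-sequences⁺ vs t zero [] refl _ = here refl
∈-sequences⁺ vs t (suc k) (v ∷ μ) refl parts∈ =
  ∈ₚ.∈-concatMap⁺ (λ w → map (w ∷_) (sequences vs (suc t) k)) (lose v∈ (∈ₚ.∈-map⁺ (v ∷_) μ∈))
  where
  v∈ : v ∈ vs t
  v∈ = subst (λ s → v ∈ vs s) (ℕₚ.+-identityʳ t) (parts∈ 0 (s≤s z≤n))
  μ∈ : μ ∈ sequences vs (suc t) k
  μ∈ = ∈-sequences⁺ vs (suc t) k μ refl (λ i i<k → subst (λ s → part μ i ∈ vs s) (ℕₚ.+-suc t i) (parts∈ (suc i) (s≤s i<k)))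

part-beyond : ∀ (l : List ℕ) i → length l ≤ i → part l i ≡ 0
part-beyond [] i _ = refl
part-beyond (a ∷ l) (suc i) (s≤s |l|≤i) = part-beyond l i |l|≤i

≺⇒partition : ∀ {ν κ} → ν ≺ κ → IsPartition ν
≺⇒partition ν≺κ i = ℕₚ.≤-trans (proj₁ (ν≺κ (suc i))) (proj₂ (ν≺κ i))

length-interlacing : ∀ {la k μ} → μ ∈ interlacing la k → length μ ≡ k
length-interlacing {la} = length-sequences {betweenParts la}

interlacing-unique : ∀ la k → Unique (interlacing la k)
interlacing-unique la k = sequences-unique (betweenParts la) 0 k (λ s → interval-unique _ _)

∈-interlacing⁻ : ∀ {la k μ} → IsPartition la → μ ∈ interlacing la k →
                 ∀ i → i < k → part μ i ≤ part la i × part la (suc i) ≤ part μ i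
∈-interlacing⁻ {la} {k} {μ} la-partition μ∈ i i<k with ∈-interval⁻ _ _ (part μ i) (∈-sequences⁻ {betweenParts la} μ∈ i i<k)
... | laᵢ₊₁≤μᵢ , μᵢ≤ = ℕₚ.≤-trans μᵢ≤ (ℕₚ.≤-reflexive (ℕₚ.m+[n∸m]≡n (la-partition i))) , laᵢ₊₁≤μᵢ

interlacing⇒≺ : ∀ {la k μ} → IsPartition la → length la ≤ suc k → μ ∈ interlacing la k → μ ≺ la
interlacing⇒≺ {la} {k} {μ} la-partition |la|≤1+k μ∈ i with i ℕ.<? k
... | yes i<k = ∈-interlacing⁻ {la} la-partition μ∈ i i<k
... | no i≮k = subst (_≤ part la i) (sym μᵢ≡0) z≤n , subst (part la (suc i) ≤_) (sym μᵢ≡0) (ℕₚ.≤-reflexive laᵢ₊₁≡0)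
  where
  μᵢ≡0 : part μ i ≡ 0
  μᵢ≡0 = part-beyond μ i (ℕₚ.≤-trans (ℕₚ.≤-reflexive (length-interlacing {la} μ∈)) (ℕₚ.≮⇒≥ i≮k))
  laᵢ₊₁≡0 : part la (suc i) ≡ 0
  laᵢ₊₁≡0 = part-beyond la (suc i) (ℕₚ.≤-trans |la|≤1+k (s≤s (ℕₚ.≮⇒≥ i≮k)))

≺⇒interlacing : ∀ {la k μ} → length μ ≡ k → μ ≺ la → μ ∈ interlacing la k
≺⇒interlacing {la} {k} {μ} |μ|≡k μ≺la = ∈-sequences⁺ (betweenParts la) 0 k μ |μ|≡k between
  where
  between : ∀ i → i < k → part μ i ∈ betweenParts la i
  between i _ = ∈-interval⁺ _ _ (part μ i) (proj₂ (μ≺la i))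
                  (ℕₚ.≤-trans (proj₁ (μ≺la i)) (ℕₚ.m≤n+m∸n (part la i) (part la (suc i))))

-- Gelfand–Tsetlin patterns as lists of layers

layer : List (List ℕ) → ℕ → List ℕ
layer [] _ = []
layer (a ∷ zs) zero = a
layer (a ∷ zs) (suc k) = layer zs k

-- Defs.zAt recurses through a helper local to its where block, which cannot be named;
-- zAt-helper is that helper, obtained as the solution of the unification problem in zAt-unfold.
mutual
  zAt-helper : (n : ℕ) → Pat n → ℕ → List (List ℕ) → ℕ → List ℕ
  zAt-helper = _

  zAt-unfold : ∀ n a v k → zAt n (a Vec.∷ v) (suc k) ≡ zAt-helper n (a Vec.∷ v) (suc k) (toList v) k
  zAt-unfold n a v k with a Vec.∷ v | suc k | toList v
  ... | z | k′ | zs = refl {x = zAt-helper n z k′ zs k}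

zAt-helper≡layer : ∀ n z k′ zs k → zAt-helper n z k′ zs k ≡ layer zs k
zAt-helper≡layer n z k′ [] k = refl
zAt-helper≡layer n z k′ (a ∷ zs) zero = refl
zAt-helper≡layer n z k′ (a ∷ zs) (suc k) = zAt-helper≡layer n z k′ zs k

zAt≡layer : ∀ n z k → zAt n z k ≡ layer (toList z) k
zAt≡layer n (a Vec.∷ v) zero = refl
zAt≡layer n (a Vec.∷ v) (suc k) = trans (zAt-unfold n a v k) (zAt-helper≡layer n (a Vec.∷ v) (suc k) (toList v) k)

lookup≡layer : ∀ {m} (v : Vec (List ℕ) m) (k : Fin m) → lookup v k ≡ layer (toList v) (toℕ k)
lookup≡layer (a Vec.∷ v) zero = refl
lookup≡layer (a Vec.∷ v) (suc k) = lookup≡layer v k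

layer-++ˡ : ∀ zs ys k → k < length zs → layer (zs ++ ys) k ≡ layer zs k
layer-++ˡ (a ∷ zs) ys zero _ = refl
layer-++ˡ (a ∷ zs) ys (suc k) (s≤s k<) = layer-++ˡ zs ys k k<

layer-++ʳ : ∀ zs ys j → layer (zs ++ ys) (length zs ℕ.+ j) ≡ layer ys j
layer-++ʳ [] ys j = refl
layer-++ʳ (a ∷ zs) ys j = layer-++ʳ zs ys j

record GTLayers (m : ℕ) (top : List ℕ) (zs : List (List ℕ)) : Set where
  field
    length-layers : length zs ≡ suc m
    layer-lengths : ∀ k → k ≤ m → length (layer zs k) ≡ ⌈ k /2⌉
    bottom-layer  : layer zs 0 ≡ []
    top-layer     : layer zs m ≡ top
    interlace     : ∀ k → k < m → layer zs k ≺ layer zs (suc k)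

data TwoMore (m : ℕ) : ℕ → Set where
  below : ∀ {k} → k ≤ m → TwoMore m k
  next  : TwoMore m (suc m)
  next₂ : TwoMore m (suc (suc m))

twoMore : ∀ m k → k ≤ suc (suc m) → TwoMore m k
twoMore m k k≤ with ℕₚ.m≤n⇒m<n∨m≡n k≤
... | inj₂ refl = next₂
... | inj₁ (s≤s k≤1+m) with ℕₚ.m≤n⇒m<n∨m≡n k≤1+m
...   | inj₂ refl = next
...   | inj₁ (s≤s k≤m) = below k≤m

module _ {m : ℕ} {zs : List (List ℕ)} (length-zs : length zs ≡ suc m) (μ t : List ℕ) where

  private
    zs′ = zs ++ μ ∷ t ∷ []

    layer-new : ∀ j → layer zs′ (suc m ℕ.+ j) ≡ layer (μ ∷ t ∷ []) j
    layer-new j = trans (cong (λ l → layer zs′ (l ℕ.+ j)) (sym length-zs)) (layer-++ʳ zs (μ ∷ t ∷ []) j)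

  layer-old : ∀ k → k ≤ m → layer zs′ k ≡ layer zs k
  layer-old k k≤m = layer-++ˡ zs (μ ∷ t ∷ []) k (ℕₚ.≤-trans (s≤s k≤m) (ℕₚ.≤-reflexive (sym length-zs)))

  layer-μ : layer zs′ (suc m) ≡ μ
  layer-μ = trans (cong (layer zs′) (cong suc (sym (ℕₚ.+-identityʳ m)))) (layer-new 0)

  layer-t : layer zs′ (suc (suc m)) ≡ t
  layer-t = trans (cong (layer zs′) (cong suc (ℕₚ.+-comm 1 m))) (layer-new 1)

  GTLayers-extend : ∀ {ρ} → GTLayers m ρ zs → length μ ≡ ⌈ suc m /2⌉ → length t ≡ ⌈ suc (suc m) /2⌉ →
                    ρ ≺ μ → μ ≺ t → GTLayers (suc (suc m)) t zs′
  GTLayers-extend {ρ} zs-layers |μ| |t| ρ≺μ μ≺t = record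
    { length-layers = trans (Listₚ.length-++ zs) (trans (cong (ℕ._+ 2) length-zs) (cong suc (ℕₚ.+-comm m 2)))
    ; layer-lengths = lengths
    ; bottom-layer = trans (layer-old 0 z≤n) bottom-layer
    ; top-layer = layer-t
    ; interlace = interlace′
    }
    where
    open GTLayers zs-layers
    lengths : ∀ k → k ≤ suc (suc m) → length (layer zs′ k) ≡ ⌈ k /2⌉
    lengths k k≤ with twoMore m k k≤
    ... | below k≤m = trans (cong length (layer-old k k≤m)) (layer-lengths k k≤m)
    ... | next = trans (cong length layer-μ) |μ|
    ... | next₂ = trans (cong length layer-t) |t|
    interlace′ : ∀ k → k < suc (suc m) → layer zs′ k ≺ layer zs′ (suc k)
    interlace′ k (s≤s k≤1+m) with twoMore m (suc k) (s≤s k≤1+m)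
    ... | below (s≤s k<m) =
      subst₂ _≺_ (sym (layer-old k (ℕₚ.<⇒≤ (s≤s k<m)))) (sym (layer-old (suc k) (s≤s k<m))) (interlace k (s≤s k<m))
    ... | next = subst₂ _≺_ (sym (trans (layer-old m ℕₚ.≤-refl) top-layer)) (sym layer-μ) ρ≺μ
    ... | next₂ = subst₂ _≺_ (sym layer-μ) (sym layer-t) μ≺t

  GTLayers-restrict : ∀ {top} → GTLayers (suc (suc m)) top zs′ →
                      GTLayers m (layer zs m) zs × length μ ≡ ⌈ suc m /2⌉ × length t ≡ ⌈ suc (suc m) /2⌉ ×
                      t ≡ top × layer zs m ≺ μ × μ ≺ t
  GTLayers-restrict zs′-layers =
    record
      { length-layers = length-zs
      ; layer-lengths = λ k k≤m → trans (cong length (sym (layer-old k k≤m))) (layer-lengths k (ℕₚ.m≤n⇒m≤o+n 2 k≤m))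
      ; bottom-layer = trans (sym (layer-old 0 z≤n)) bottom-layer
      ; top-layer = refl
      ; interlace = λ k k<m → subst₂ _≺_ (layer-old k (ℕₚ.<⇒≤ k<m)) (layer-old (suc k) k<m)
                                         (interlace k (ℕₚ.m≤n⇒m≤o+n 2 k<m))
      }
    , trans (cong length (sym layer-μ)) (layer-lengths (suc m) (ℕₚ.n≤1+n _))
    , trans (cong length (sym layer-t)) (layer-lengths (suc (suc m)) ℕₚ.≤-refl)
    , trans (sym layer-t) top-layer
    , subst₂ _≺_ (layer-old m ℕₚ.≤-refl) layer-μ (interlace m (ℕₚ.m≤n⇒m≤o+n 1 (ℕₚ.n<1+n m)))
    , subst₂ _≺_ layer-μ layer-t (interlace (suc m) ℕₚ.≤-refl)
    where
    open GTLayers zs′-layers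

⌊2n/2⌋≡n : ∀ n → ℕ.⌊ 2 ℕ.* n /2⌋ ≡ n
⌊2n/2⌋≡n zero = refl
⌊2n/2⌋≡n (suc n) = trans (cong ℕ.⌊_/2⌋ (ℕₚ.*-suc 2 n)) (cong suc (⌊2n/2⌋≡n n))

⌈2n/2⌉≡n : ∀ n → ⌈ 2 ℕ.* n /2⌉ ≡ n
⌈2n/2⌉≡n zero = refl
⌈2n/2⌉≡n (suc n) = trans (cong ⌈_/2⌉ (ℕₚ.*-suc 2 n)) (cong suc (⌈2n/2⌉≡n n))

two-more-layers : ∀ n → suc (suc (2 ℕ.* n)) ℕ.+ 2 ≡ suc (suc (2 ℕ.* suc n))
two-more-layers n = trans (ℕₚ.+-comm (suc (suc (2 ℕ.* n))) 2) (cong (λ k → ℕ.suc (ℕ.suc k)) (sym (ℕₚ.*-suc 2 n)))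

extendPat : ∀ n → Pat n → List ℕ → List ℕ → Pat (suc n)
extendPat n Z μ t = Vec.cast (two-more-layers n) (Z Vec.++ (μ Vec.∷ t Vec.∷ Vec.[]))

toList-extendPat : ∀ n Z μ t → toList (extendPat n Z μ t) ≡ toList Z ++ μ ∷ t ∷ []
toList-extendPat n Z μ t = trans (Vecₚ.toList-cast _ _) (Vecₚ.toList-++ Z (μ Vec.∷ t Vec.∷ Vec.[]))

length-toList-Pat : ∀ n (Z : Pat n) → length (toList Z) ≡ suc (suc (2 ℕ.* n))
length-toList-Pat n Z = Vecₚ.length-toList Z

extendPat-injective : ∀ n {Z Z′ μ μ′ t t′} → extendPat n Z μ t ≡ extendPat n Z′ μ′ t′ → Z ≡ Z′
extendPat-injective n {Z} {Z′} {μ} {μ′} {t} {t′} eq =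
  trans (sym (Vecₚ.cast-is-id refl Z))
        (Vecₚ.toList-injective refl Z Z′ (prefix (toList Z) (toList Z′) same-length lists))
  where
  lists : toList Z ++ μ ∷ t ∷ [] ≡ toList Z′ ++ μ′ ∷ t′ ∷ []
  lists = trans (sym (toList-extendPat n Z μ t)) (trans (cong toList eq) (toList-extendPat n Z′ μ′ t′))
  same-length : length (toList Z) ≡ length (toList Z′)
  same-length = trans (length-toList-Pat n Z) (sym (length-toList-Pat n Z′))
  prefix : ∀ (xs ys : List (List ℕ)) {xs′ ys′} → length xs ≡ length ys → xs ++ xs′ ≡ ys ++ ys′ → xs ≡ ys
  prefix [] [] _ _ = refl
  prefix (x ∷ xs) (y ∷ ys) |xs|≡|ys| eq′ =
    cong₂ _∷_ (Listₚ.∷-injectiveˡ eq′) (prefix xs ys (ℕₚ.suc-injective |xs|≡|ys|) (Listₚ.∷-injectiveʳ eq′))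

extendPat-surjective : ∀ n (z : Pat (suc n)) → Σ (Pat n) λ Z → Σ (List ℕ) λ μ → Σ (List ℕ) λ t → z ≡ extendPat n Z μ t
extendPat-surjective n z with Vec.splitAt (suc (suc (2 ℕ.* n))) {2} (Vec.cast (sym (two-more-layers n)) z)
... | Z , (μ Vec.∷ t Vec.∷ Vec.[]) , z≡ =
  Z , μ , t , trans (sym (Vecₚ.cast-is-id refl z)) (Vecₚ.toList-injective refl z (extendPat n Z μ t) (begin
  toList z                                                   ≡⟨ Vecₚ.toList-cast _ z ⟨
  toList (Vec.cast (sym (two-more-layers n)) z)              ≡⟨ cong toList z≡ ⟩
  toList (Z Vec.++ (μ Vec.∷ t Vec.∷ Vec.[]))                  ≡⟨ Vecₚ.toList-++ Z _ ⟩
  toList Z ++ μ ∷ t ∷ []                                      ≡⟨ toList-extendPat n Z μ t ⟨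
  toList (extendPat n Z μ t)                                 ∎))

module _ (n : ℕ) (Z : Pat n) (μ t : List ℕ) where

  private
    layers-Z = length-toList-Pat n Z
    Z′ = toList (extendPat n Z μ t)

  layer-extendPat-old : ∀ k → k ≤ suc (2 ℕ.* n) → layer Z′ k ≡ layer (toList Z) k
  layer-extendPat-old k k≤ = trans (cong (λ l → layer l k) (toList-extendPat n Z μ t)) (layer-old {zs = toList Z} layers-Z μ t k k≤)

  layer-extendPat-μ : layer Z′ (2 ℕ.* suc n) ≡ μ
  layer-extendPat-μ = trans (cong₂ layer (toList-extendPat n Z μ t) (ℕₚ.*-suc 2 n)) (layer-μ {zs = toList Z} layers-Z μ t)

  layer-extendPat-t : layer Z′ (suc (2 ℕ.* suc n)) ≡ t
  layer-extendPat-t = trans (cong₂ layer (toList-extendPat n Z μ t) (cong suc (ℕₚ.*-suc 2 n))) (layer-t {zs = toList Z} layers-Z μ t)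

patterns : (n : ℕ) → List ℕ → List (Pat n)
patterns zero top = ([] Vec.∷ top Vec.∷ Vec.[]) ∷ []
patterns (suc n) top =
  concatMap (λ μ → concatMap (λ ρ → map (λ Z → extendPat n Z μ top) (patterns n ρ)) (interlacing μ (suc n)))
            (interlacing top (suc n))

∈-patterns-suc⁻ : ∀ {n top z} → z ∈ patterns (suc n) top →
                  Σ (List ℕ) λ μ → Σ (List ℕ) λ ρ → Σ (Pat n) λ Z →
                  μ ∈ interlacing top (suc n) × ρ ∈ interlacing μ (suc n) × Z ∈ patterns n ρ × z ≡ extendPat n Z μ top
∈-patterns-suc⁻ {n} {top} z∈ with find (∈ₚ.∈-concatMap⁻ _ {xs = interlacing top (suc n)} z∈)
... | μ , μ∈ , z∈μ with find (∈ₚ.∈-concatMap⁻ _ {xs = interlacing μ (suc n)} z∈μ)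
...   | ρ , ρ∈ , z∈ρ with ∈ₚ.∈-map⁻ (λ Z → extendPat n Z μ top) z∈ρ
...     | Z , Z∈ , z≡ = μ , ρ , Z , μ∈ , ρ∈ , Z∈ , z≡

∈-patterns-suc⁺ : ∀ {n top μ ρ Z} → μ ∈ interlacing top (suc n) → ρ ∈ interlacing μ (suc n) → Z ∈ patterns n ρ →
                  extendPat n Z μ top ∈ patterns (suc n) top
∈-patterns-suc⁺ {n} {top} {μ} μ∈ ρ∈ Z∈ =
  ∈ₚ.∈-concatMap⁺ _ (lose μ∈ (∈ₚ.∈-concatMap⁺ _ (lose ρ∈ (∈ₚ.∈-map⁺ (λ Z → extendPat n Z μ top) Z∈))))

patterns-top : ∀ {n top z} → z ∈ patterns n top → layer (toList z) (suc (2 ℕ.* n)) ≡ top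
patterns-top {zero} (here refl) = refl
patterns-top {suc n} {top} z∈ with ∈-patterns-suc⁻ {n} {top} z∈
... | μ , ρ , Z , _ , _ , _ , refl = layer-extendPat-t n Z μ top

patterns-unique : ∀ n top → Unique (patterns n top)
patterns-unique zero top = All.[] ∷ []
patterns-unique (suc n) top =
  concatMap-unique blocks (λ z → layer (toList z) (2 ℕ.* suc n)) (interlacing top (suc n)) blocks-μ (interlacing-unique top (suc n))
    (λ μ _ → concatMap-unique (block μ) (λ z → layer (toList z) (suc (2 ℕ.* n))) (interlacing μ (suc n)) (block-ρ μ)
               (interlacing-unique μ (suc n))
               (λ ρ _ → Uniqueₚ.map⁺ (extendPat-injective n) (patterns-unique n ρ)))
  where
  block : List ℕ → List ℕ → List (Pat (suc n))
  block μ ρ = map (λ Z → extendPat n Z μ top) (patterns n ρ)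
  blocks : List ℕ → List (Pat (suc n))
  blocks μ = concatMap (block μ) (interlacing μ (suc n))
  block-ρ : ∀ μ ρ z → z ∈ block μ ρ → layer (toList z) (suc (2 ℕ.* n)) ≡ ρ
  block-ρ μ ρ z z∈ with ∈ₚ.∈-map⁻ (λ Z → extendPat n Z μ top) z∈
  ... | Z , Z∈ , refl = trans (layer-extendPat-old n Z μ top (suc (2 ℕ.* n)) ℕₚ.≤-refl) (patterns-top {n} Z∈)
  blocks-μ : ∀ μ z → z ∈ blocks μ → layer (toList z) (2 ℕ.* suc n) ≡ μ
  blocks-μ μ z z∈ with find (∈ₚ.∈-concatMap⁻ (block μ) {xs = interlacing μ (suc n)} z∈)
  ... | ρ , _ , z∈ρ with ∈ₚ.∈-map⁻ (λ Z → extendPat n Z μ top) z∈ρ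
  ...   | Z , _ , refl = layer-extendPat-μ n Z μ top

patterns-sound : ∀ n {top z} → IsPartition top → length top ≡ suc n → z ∈ patterns n top →
                 GTLayers (suc (2 ℕ.* n)) top (toList z)
patterns-sound zero {top} _ |top| (here refl) = record
  { length-layers = refl
  ; layer-lengths = lengths
  ; bottom-layer = refl
  ; top-layer = refl
  ; interlace = interlace
  }
  where
  interlace : ∀ k → k < 1 → layer ([] ∷ top ∷ []) k ≺ layer ([] ∷ top ∷ []) (suc k)
  interlace zero _ i = z≤n , ℕₚ.≤-reflexive (part-beyond top (suc i) (ℕₚ.≤-trans (ℕₚ.≤-reflexive |top|) (s≤s z≤n)))
  interlace (suc k) (s≤s ())
  lengths : ∀ k → k ≤ 1 → length (layer ([] ∷ top ∷ []) k) ≡ ⌈ k /2⌉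
  lengths zero _ = refl
  lengths (suc zero) _ = |top|
  lengths (suc (suc k)) (s≤s ())
patterns-sound (suc n) {top} top-partition |top| z∈ with ∈-patterns-suc⁻ {n} {top} z∈
... | μ , ρ , Z , μ∈ , ρ∈ , Z∈ , refl =
  subst₂ (λ m zs → GTLayers m top zs) (cong suc (sym (ℕₚ.*-suc 2 n))) (sym (toList-extendPat n Z μ top))
    (GTLayers-extend (length-toList-Pat n Z) μ top Z-layers
       (trans |μ| (cong suc (sym (⌈2n/2⌉≡n n))))
       (trans |top| (cong (λ k → suc (suc k)) (sym (⌊2n/2⌋≡n n))))
       ρ≺μ μ≺top)
  where
  |μ| = length-interlacing {top} μ∈
  μ≺top = interlacing⇒≺ {top} top-partition (ℕₚ.≤-reflexive |top|) μ∈
  ρ≺μ = interlacing⇒≺ {μ} (≺⇒partition {μ} {top} μ≺top) (ℕₚ.≤-trans (ℕₚ.≤-reflexive |μ|) (ℕₚ.n≤1+n _)) ρ∈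
  Z-layers = patterns-sound n (≺⇒partition {ρ} {μ} ρ≺μ) (length-interlacing {μ} ρ∈) Z∈

patterns-complete : ∀ n {top z} → GTLayers (suc (2 ℕ.* n)) top (toList z) → z ∈ patterns n top
patterns-complete zero {top} {a Vec.∷ b Vec.∷ Vec.[]} layers =
  here (cong₂ (λ u v → u Vec.∷ v Vec.∷ Vec.[]) bottom-layer top-layer)
  where open GTLayers layers
patterns-complete (suc n) {top} {z} layers with extendPat-surjective n z
... | Z , μ , t , refl
  with GTLayers-restrict (length-toList-Pat n Z) μ t
         (subst₂ (λ m zs → GTLayers m top zs) (cong suc (ℕₚ.*-suc 2 n)) (toList-extendPat n Z μ t) layers)
...   | Z-layers , |μ| , _ , refl , ρ≺μ , μ≺t =
  ∈-patterns-suc⁺ (≺⇒interlacing {top} (trans |μ| (cong suc (⌈2n/2⌉≡n n))) μ≺t)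
                  (≺⇒interlacing {μ} |ρ| ρ≺μ)
                  (patterns-complete n Z-layers)
  where
  |ρ| : length (layer (toList Z) (suc (2 ℕ.* n))) ≡ suc n
  |ρ| = trans (GTLayers.layer-lengths Z-layers (suc (2 ℕ.* n)) ℕₚ.≤-refl) (cong suc (⌊2n/2⌋≡n n))

-- Weights

seqWeight-suc : ∀ α t μ → seqWeight α (suc t) μ ≡ seqWeight (α ∘ suc) t μ
seqWeight-suc α t [] = refl
seqWeight-suc α t (v ∷ μ) = cong (α (suc t) v *_) (seqWeight-suc α (suc t) μ)

seqWeight-snoc : ∀ α t μ v → seqWeight α t (μ ++ [ v ]) ≡ seqWeight α t μ * α (t ℕ.+ length μ) v
seqWeight-snoc α t [] v =
  trans (ℚₚ.*-identityʳ (α t v)) (sym (trans (ℚₚ.*-identityˡ _) (cong (λ s → α s v) (ℕₚ.+-identityʳ t))))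
seqWeight-snoc α t (w ∷ μ) v = begin
  α t w * seqWeight α (suc t) (μ ++ [ v ])                   ≡⟨ cong (α t w *_) (seqWeight-snoc α (suc t) μ v) ⟩
  α t w * (seqWeight α (suc t) μ * α (suc t ℕ.+ length μ) v)  ≡⟨ ℚₚ.*-assoc (α t w) _ _ ⟨
  α t w * seqWeight α (suc t) μ * α (suc t ℕ.+ length μ) v    ≡⟨ cong (λ s → α t w * seqWeight α (suc t) μ * α s v) (ℕₚ.+-suc t (length μ)) ⟨
  α t w * seqWeight α (suc t) μ * α (t ℕ.+ suc (length μ)) v  ∎

size-mono : ∀ μ la → (∀ i → part μ i ≤ part la i) → size μ ≤ size la
size-mono [] la _ = z≤n
size-mono (v ∷ μ) [] μ≤la = ℕₚ.+-mono-≤ (μ≤la 0) (size-mono μ [] (μ≤la ∘ suc))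
size-mono (v ∷ μ) (a ∷ la) μ≤la = ℕₚ.+-mono-≤ (μ≤la 0) (size-mono μ la (μ≤la ∘ suc))

∸-+-distrib : ∀ a b c d → b ≤ a → d ≤ c → (a ∸ b) ℕ.+ (c ∸ d) ≡ (a ℕ.+ c) ∸ (b ℕ.+ d)
∸-+-distrib a b c d b≤a d≤c = begin
  (a ∸ b) ℕ.+ (c ∸ d)  ≡⟨ ℕₚ.+-∸-assoc (a ∸ b) d≤c ⟨
  (a ∸ b) ℕ.+ c ∸ d    ≡⟨ cong (_∸ d) (ℕₚ.+-∸-comm c b≤a) ⟨
  a ℕ.+ c ∸ b ∸ d      ≡⟨ ℕₚ.∸-+-assoc (a ℕ.+ c) b d ⟩
  a ℕ.+ c ∸ (b ℕ.+ d)  ∎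

seqWeight-powGap : ∀ c la μ → length μ ≡ length la → (∀ i → part μ i ≤ part la i) →
                   seqWeight (powGap c la) 0 μ ≡ pow c (size la ∸ size μ)
seqWeight-powGap c [] [] _ _ = refl
seqWeight-powGap c (a ∷ la) (v ∷ μ) |μ|≡|la| μ≤la = begin
  pow c (a ∸ v) * seqWeight (powGap c (a ∷ la)) 1 μ
    ≡⟨ cong (pow c (a ∸ v) *_) (trans (seqWeight-suc (powGap c (a ∷ la)) 0 μ)
                                      (seqWeight-powGap c la μ (ℕₚ.suc-injective |μ|≡|la|) (μ≤la ∘ suc))) ⟩
  pow c (a ∸ v) * pow c (size la ∸ size μ)
    ≡⟨ pow-+ c (a ∸ v) (size la ∸ size μ) ⟨
  pow c ((a ∸ v) ℕ.+ (size la ∸ size μ))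
    ≡⟨ cong (pow c) (∸-+-distrib a v (size la) (size μ) (μ≤la 0) (size-mono μ la (μ≤la ∘ suc))) ⟩
  pow c (a ℕ.+ size la ∸ (v ℕ.+ size μ)) ∎

part-++-[0] : ∀ μ i → part (μ ++ [ 0 ]) i ≡ part μ i
part-++-[0] [] zero = refl
part-++-[0] [] (suc i) = refl
part-++-[0] (a ∷ μ) zero = refl
part-++-[0] (a ∷ μ) (suc i) = part-++-[0] μ i

size-++-[0] : ∀ μ → size (μ ++ [ 0 ]) ≡ size μ
size-++-[0] μ = trans (ℕ-List.sum-++ μ [ 0 ]) (ℕₚ.+-identityʳ (size μ))

∣_∣ᶻ : List ℕ → ℤ
∣ μ ∣ᶻ = ℤ.+ size μ

ipow-⊖ : ∀ x → x ≢ 0ℚ → ∀ m n → ipow x (m ⊖ n) ≡ pow x m * pow (inv x) n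
ipow-⊖ x x≢0 zero zero = sym (ℚₚ.*-identityˡ 1ℚ)
ipow-⊖ x x≢0 (suc m) zero = sym (ℚₚ.*-identityʳ _)
ipow-⊖ x x≢0 zero (suc n) = sym (ℚₚ.*-identityˡ _)
ipow-⊖ x x≢0 (suc m) (suc n) = begin
  ipow x (suc m ⊖ suc n)                          ≡⟨ cong (ipow x) (ℤₚ.[1+m]⊖[1+n]≡m⊖n m n) ⟩
  ipow x (m ⊖ n)                                  ≡⟨ ipow-⊖ x x≢0 m n ⟩
  pow x m * pow (inv x) n                         ≡⟨ ℚₚ.*-identityˡ _ ⟨
  1ℚ * (pow x m * pow (inv x) n)                  ≡⟨ cong (_* (pow x m * pow (inv x) n)) (inv-inverseʳ x x≢0) ⟨
  (x * inv x) * (pow x m * pow (inv x) n)         ≡⟨ regroup x (inv x) (pow x m) (pow (inv x) n) ⟩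
  (x * pow x m) * (inv x * pow (inv x) n)         ∎
  where
  regroup : ∀ u ui a b → (u * ui) * (a * b) ≡ (u * a) * (ui * b)
  regroup = solve-∀ ℚ-ring

ipow-+ : ∀ x → x ≢ 0ℚ → ∀ a b → ipow x (a ℤ.+ b) ≡ ipow x a * ipow x b
ipow-+ x x≢0 (ℤ.+ m) (ℤ.+ n) = pow-+ x m n
ipow-+ x x≢0 (ℤ.+ m) -[1+ n ] = ipow-⊖ x x≢0 m (suc n)
ipow-+ x x≢0 -[1+ m ] (ℤ.+ n) = trans (ipow-⊖ x x≢0 n (suc m)) (ℚₚ.*-comm (pow x n) (pow (inv x) (suc m)))
ipow-+ x x≢0 -[1+ m ] -[1+ n ] =
  trans (cong (pow (inv x)) (cong suc (sym (ℕₚ.+-suc m n)))) (pow-+ (inv x) (suc m) (suc n))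

ipow-- : ∀ x d → ipow x (ℤ.- (ℤ.+ d)) ≡ pow (inv x) d
ipow-- x zero = refl
ipow-- x (suc d) = refl

ipow-∸-≥ : ∀ x a b → b ≤ a → ipow x (ℤ.+ a ℤ.- ℤ.+ b) ≡ pow x (a ∸ b)
ipow-∸-≥ x a b b≤a = cong (ipow x) (trans (ℤₚ.m-n≡m⊖n a b) (ℤₚ.⊖-≥ b≤a))

ipow-∸-≤ : ∀ x a b → a ≤ b → ipow x (ℤ.+ a ℤ.- ℤ.+ b) ≡ pow (inv x) (b ∸ a)
ipow-∸-≤ x a b a≤b = trans (cong (ipow x) (trans (ℤₚ.m-n≡m⊖n a b) (ℤₚ.⊖-≤ a≤b))) (ipow-- x (b ∸ a))

seqWeight-powGap-inv : ∀ c la μ → length μ ≡ length la → (∀ i → part μ i ≤ part la i) →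
                       seqWeight (powGap (inv c) la) 0 μ ≡ ipow c (∣ μ ∣ᶻ ℤ.- ∣ la ∣ᶻ)
seqWeight-powGap-inv c la μ |μ|≡|la| μ≤la =
  trans (seqWeight-powGap (inv c) la μ |μ|≡|la| μ≤la) (sym (ipow-∸-≤ c (size μ) (size la) (size-mono μ la μ≤la)))

seqWeight-powGap-shorter : ∀ c la μ → length la ≡ suc (length μ) → (∀ i → part μ i ≤ part la i) →
                           pow c (part la (length μ)) * seqWeight (powGap c la) 0 μ ≡ ipow c (∣ la ∣ᶻ ℤ.- ∣ μ ∣ᶻ)
seqWeight-powGap-shorter c la μ |la| μ≤la = begin
  pow c (part la (length μ)) * seqWeight (powGap c la) 0 μ
    ≡⟨ ℚₚ.*-comm (pow c (part la (length μ))) (seqWeight (powGap c la) 0 μ) ⟩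
  seqWeight (powGap c la) 0 μ * powGap c la (length μ) 0
    ≡⟨ seqWeight-snoc (powGap c la) 0 μ 0 ⟨
  seqWeight (powGap c la) 0 (μ ++ [ 0 ])
    ≡⟨ seqWeight-powGap c la (μ ++ [ 0 ]) |μ0| μ0≤la ⟩
  pow c (size la ∸ size (μ ++ [ 0 ]))
    ≡⟨ ipow-∸-≥ c (size la) (size (μ ++ [ 0 ])) (size-mono (μ ++ [ 0 ]) la μ0≤la) ⟨
  ipow c (∣ la ∣ᶻ ℤ.- ∣ μ ++ [ 0 ] ∣ᶻ)
    ≡⟨ cong (λ s → ipow c (∣ la ∣ᶻ ℤ.- ℤ.+ s)) (size-++-[0] μ) ⟩
  ipow c (∣ la ∣ᶻ ℤ.- ∣ μ ∣ᶻ) ∎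
  where
  |μ0| : length (μ ++ [ 0 ]) ≡ length la
  |μ0| = trans (Listₚ.length-++ μ) (trans (ℕₚ.+-comm (length μ) 1) (sym |la|))
  μ0≤la : ∀ i → part (μ ++ [ 0 ]) i ≤ part la i
  μ0≤la i = subst (_≤ part la i) (sym (part-++-[0] μ i)) (μ≤la i)

sz≡size-layer : ∀ n z k → sz n z k ≡ ℤ.+ size (layer (toList z) k)
sz≡size-layer n z k = cong (λ l → ℤ.+ size l) (zAt≡layer n z k)

weight-extendPat :
  ∀ n (x : Fin (suc (suc n)) → ℚ) (Z : Pat n) μ top → x (inject₁ (fromℕ n)) ≢ 0ℚ →
  weight (suc n) x (extendPat n Z μ top)
    ≡ ipow (zOf x) (∣ top ∣ᶻ ℤ.- ∣ μ ∣ᶻ)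
      * (ipow (x (inject₁ (fromℕ n))) (∣ layer (toList Z) (suc (2 ℕ.* n)) ∣ᶻ ℤ.- ∣ μ ∣ᶻ) * weight n (x ∘ inject₁) Z)
weight-extendPat n x Z μ top w≢0 = begin
  ipow (zOf x) (sz (suc n) W (suc (2 ℕ.* suc n)) ℤ.- sz (suc n) W (2 ℕ.* suc n)) * prodFin f
    ≡⟨ cong₂ _*_ (cong (ipow (zOf x)) top-exponent) (prodFin-init-last f) ⟩
  ipow (zOf x) (∣ top ∣ᶻ ℤ.- ∣ μ ∣ᶻ) * (prodFin (f ∘ inject₁) * f (fromℕ n))
    ≡⟨ cong (λ p → ipow (zOf x) (∣ top ∣ᶻ ℤ.- ∣ μ ∣ᶻ) * (p * f (fromℕ n))) (prodFin-cong old-factor) ⟩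
  ipow (zOf x) (∣ top ∣ᶻ ℤ.- ∣ μ ∣ᶻ) * (prodFin g * f (fromℕ n))
    ≡⟨ cong (λ p → ipow (zOf x) (∣ top ∣ᶻ ℤ.- ∣ μ ∣ᶻ) * (prodFin g * p)) last-factor ⟩
  ipow (zOf x) (∣ top ∣ᶻ ℤ.- ∣ μ ∣ᶻ) * (prodFin g * (ipow w (R ℤ.- M) * ipow w (R ℤ.- V)))
    ≡⟨ regroup (ipow (zOf x) (∣ top ∣ᶻ ℤ.- ∣ μ ∣ᶻ)) (prodFin g) (ipow w (R ℤ.- M)) (ipow w (R ℤ.- V)) ⟩
  ipow (zOf x) (∣ top ∣ᶻ ℤ.- ∣ μ ∣ᶻ) * (ipow w (R ℤ.- M) * (ipow w (R ℤ.- V) * prodFin g))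
    ≡⟨ cong (λ e → ipow (zOf x) (∣ top ∣ᶻ ℤ.- ∣ μ ∣ᶻ) * (ipow w (R ℤ.- M) * (ipow w e * prodFin g)))
            (sym (cong₂ ℤ._-_ (sz≡size-layer n Z _) (sz≡size-layer n Z _))) ⟩
  ipow (zOf x) (∣ top ∣ᶻ ℤ.- ∣ μ ∣ᶻ) * (ipow w (R ℤ.- M) * weight n x′ Z) ∎
  where
  W = extendPat n Z μ top
  x′ = x ∘ inject₁
  w = x (inject₁ (fromℕ n))
  R = ∣ layer (toList Z) (suc (2 ℕ.* n)) ∣ᶻ
  V = ∣ layer (toList Z) (2 ℕ.* n) ∣ᶻ
  M = ∣ μ ∣ᶻ
  exponent : (m : ℕ) → Pat m → ℕ → ℤ
  exponent m z k = ℤ.+ 2 ℤ.* sz m z (suc (2 ℕ.* k)) ℤ.- sz m z (suc (suc (2 ℕ.* k))) ℤ.- sz m z (2 ℕ.* k)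
  f : Fin (suc n) → ℚ
  f i = ipow (x (inject₁ i)) (exponent (suc n) W (toℕ i))
  g : Fin n → ℚ
  g i = ipow (x′ (inject₁ i)) (exponent n Z (toℕ i))
  sz-old : ∀ k → k ≤ suc (2 ℕ.* n) → sz (suc n) W k ≡ sz n Z k
  sz-old k k≤ = trans (sz≡size-layer (suc n) W k)
                      (trans (cong (λ l → ℤ.+ size l) (layer-extendPat-old n Z μ top k k≤)) (sym (sz≡size-layer n Z k)))
  top-exponent : sz (suc n) W (suc (2 ℕ.* suc n)) ℤ.- sz (suc n) W (2 ℕ.* suc n) ≡ ∣ top ∣ᶻ ℤ.- M
  top-exponent = cong₂ ℤ._-_ (trans (sz≡size-layer (suc n) W _) (cong ∣_∣ᶻ (layer-extendPat-t n Z μ top)))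
                             (trans (sz≡size-layer (suc n) W _) (cong ∣_∣ᶻ (layer-extendPat-μ n Z μ top)))
  old-factor : ∀ i → f (inject₁ i) ≡ g i
  old-factor i = cong (ipow (x′ (inject₁ i))) (begin
    exponent (suc n) W (toℕ (inject₁ i))  ≡⟨ cong (exponent (suc n) W) (Finₚ.toℕ-inject₁ i) ⟩
    exponent (suc n) W m                  ≡⟨ cong₂ ℤ._-_ (cong₂ ℤ._-_ (cong (ℤ.+ 2 ℤ.*_) (sz-old _ (ℕₚ.<⇒≤ 2m+1<)))
                                                               (sz-old _ 2m+1<)) (sz-old _ (ℕₚ.≤-trans (ℕₚ.n≤1+n _) (ℕₚ.<⇒≤ 2m+1<))) ⟩
    exponent n Z m                  ∎)
    where
    m = toℕ i
    2m+1< : suc (2 ℕ.* m) < suc (2 ℕ.* n)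
    2m+1< = s≤s (ℕₚ.*-monoʳ-< 2 (Finₚ.toℕ<n i))
  last-factor : f (fromℕ n) ≡ ipow w (R ℤ.- M) * ipow w (R ℤ.- V)
  last-factor = begin
    ipow w (exponent (suc n) W (toℕ (fromℕ n)))  ≡⟨ cong (λ k → ipow w (exponent (suc n) W k)) (Finₚ.toℕ-fromℕ n) ⟩
    ipow w (exponent (suc n) W n)
      ≡⟨ cong (ipow w) (cong₂ ℤ._-_ (cong₂ ℤ._-_ (cong (ℤ.+ 2 ℤ.*_) (trans (sz-old _ ℕₚ.≤-refl) (sz≡size-layer n Z _)))
                                                   (trans (sz≡size-layer (suc n) W _)
                                                          (cong ∣_∣ᶻ (trans (cong (layer (toList W)) (sym (ℕₚ.*-suc 2 n)))
                                                                            (layer-extendPat-μ n Z μ top)))))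
                                     (trans (sz-old _ (ℕₚ.n≤1+n _)) (sz≡size-layer n Z _))) ⟩
    ipow w (ℤ.+ 2 ℤ.* R ℤ.- M ℤ.- V)     ≡⟨ cong (ipow w) (split R M V) ⟩
    ipow w ((R ℤ.- M) ℤ.+ (R ℤ.- V))     ≡⟨ ipow-+ w w≢0 (R ℤ.- M) (R ℤ.- V) ⟩
    ipow w (R ℤ.- M) * ipow w (R ℤ.- V)  ∎
    where
    split : ∀ r m v → ℤ.+ 2 ℤ.* r ℤ.- m ℤ.- v ≡ (r ℤ.- m) ℤ.+ (r ℤ.- v)
    split = ℤ-Solver.solve-∀
  regroup : ∀ a p b c → a * (p * (b * c)) ≡ a * (b * (c * p))
  regroup = solve-∀ ℚ-ring

interlacing-[] : ∀ t k → sequences (betweenParts []) t k ≡ [ replicate k 0 ]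
interlacing-[] t zero = refl
interlacing-[] t (suc k) rewrite interlacing-[] (suc t) k = refl

part-replicate-0 : ∀ k i → part (replicate k 0) i ≡ 0
part-replicate-0 zero i = refl
part-replicate-0 (suc k) zero = refl
part-replicate-0 (suc k) (suc i) = part-replicate-0 k i

seqWeight-powGap-[] : ∀ c t k → seqWeight (powGap c []) t (replicate k 0) ≡ 1ℚ
seqWeight-powGap-[] c t zero = refl
seqWeight-powGap-[] c t (suc k) = trans (cong (1ℚ *_) (seqWeight-powGap-[] c (suc t) k)) (ℚₚ.*-identityˡ 1ℚ)

∑interlacing-[] : ∀ c k (F : List ℕ → ℚ) → (∀ μ → (∀ i → part μ i ≡ 0) → F μ ≡ F []) →
                  ∑[ μ ← interlacing [] k ] seqWeight (powGap c []) 0 μ * F μ ≡ F []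
∑interlacing-[] c k F F-zeros = begin
  ∑[ μ ← interlacing [] k ] seqWeight (powGap c []) 0 μ * F μ
    ≡⟨ cong (λ μs → ∑[ μ ← μs ] seqWeight (powGap c []) 0 μ * F μ) (interlacing-[] 0 k) ⟩
  seqWeight (powGap c []) 0 (replicate k 0) * F (replicate k 0) + 0ℚ
    ≡⟨ ℚₚ.+-identityʳ _ ⟩
  seqWeight (powGap c []) 0 (replicate k 0) * F (replicate k 0)
    ≡⟨ cong₂ _*_ (seqWeight-powGap-[] c 0 k) (F-zeros (replicate k 0) (part-replicate-0 k)) ⟩
  1ℚ * F []
    ≡⟨ ℚₚ.*-identityˡ (F []) ⟩
  F [] ∎

-- The Weyl denominator is the numerator of the empty partition, so it obeys both branching rules.
det-denominator-branch :
  ∀ n (x : Fin (suc (suc n)) → ℚ) → (∀ i → x i ≢ 0ℚ) →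
  det (evenMatrix (suc (suc n)) [] x)
    ≡ oddAsym (zOf x) 0 (zOf x) * (prodFin (λ i → pairGap (zOf x) (x (inject₁ i))) * det (evenMatrix (suc n) [] (x ∘ inject₁)))
det-denominator-branch n x x≢0 = begin
  det (evenMatrix (suc (suc n)) [] x)
    ≡⟨ det-evenMatrix-branch (suc n) [] x (λ _ → z≤n) refl ⟩
  ∑[ ρ ← interlacing [] (suc (suc n)) ] seqWeight (powGap (inv (zOf x)) []) 0 ρ * det (oddMatrix (suc n) ρ x)
    ≡⟨ ∑interlacing-[] (inv (zOf x)) (suc (suc n)) (λ ρ → det (oddMatrix (suc n) ρ x))
         (λ ρ ρ≗0 → det-cong (λ i j → cong (λ p → oddAsym (zOf x) (p ℕ.+ (suc n ∸ toℕ j)) (x i)) (ρ≗0 (toℕ j)))) ⟩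
  det (oddMatrix (suc n) [] x)
    ≡⟨ det-oddMatrix-branch (suc n) [] x x≢0 (λ _ → z≤n) ⟩
  oddAsym (zOf x) 0 (zOf x) * (K * (∑[ μ ← interlacing [] (suc n) ] seqWeight (powGap (zOf x) []) 0 μ * det (evenMatrix (suc n) μ (x ∘ inject₁))))
    ≡⟨ cong (λ d → oddAsym (zOf x) 0 (zOf x) * (K * d))
            (∑interlacing-[] (zOf x) (suc n) (λ μ → det (evenMatrix (suc n) μ (x ∘ inject₁)))
               (λ μ μ≗0 → det-cong (λ i j → cong (λ p → asym (x (inject₁ i)) (p ℕ.+ (suc n ∸ toℕ j))) (μ≗0 (toℕ j))))) ⟩
  oddAsym (zOf x) 0 (zOf x) * (K * det (evenMatrix (suc n) [] (x ∘ inject₁))) ∎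
  where
  K = prodFin (λ i → pairGap (zOf x) (x (inject₁ i)))

∑patterns-suc :
  ∀ n top (x : Fin (suc (suc n)) → ℚ) → x (inject₁ (fromℕ n)) ≢ 0ℚ →
  ∑[ z ← patterns (suc n) top ] weight (suc n) x z
    ≡ ∑[ μ ← interlacing top (suc n) ] ∑[ ρ ← interlacing μ (suc n) ]
        (ipow (zOf x) (∣ top ∣ᶻ ℤ.- ∣ μ ∣ᶻ) * ipow (x (inject₁ (fromℕ n))) (∣ ρ ∣ᶻ ℤ.- ∣ μ ∣ᶻ))
        * (∑[ Z ← patterns n ρ ] weight n (x ∘ inject₁) Z)
∑patterns-suc n top x w≢0 =
  trans (sumOver-concatMap block (interlacing top (suc n)) (weight (suc n) x))
    (sumOver-cong (interlacing top (suc n)) λ μ _ →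
      trans (sumOver-concatMap (extensions μ) (interlacing μ (suc n)) (weight (suc n) x))
        (sumOver-cong (interlacing μ (suc n)) λ ρ _ → begin
          sumOver (extensions μ ρ) (weight (suc n) x)
            ≡⟨ sumOver-map (λ Z → extendPat n Z μ top) (patterns n ρ) (weight (suc n) x) ⟩
          ∑[ Z ← patterns n ρ ] weight (suc n) x (extendPat n Z μ top)
            ≡⟨ sumOver-cong (patterns n ρ) (λ Z Z∈ → trans (weight-extendPat n x Z μ top w≢0)
                 (cong (λ r → Iz μ * (ipow w (∣ r ∣ᶻ ℤ.- ∣ μ ∣ᶻ) * weight n (x ∘ inject₁) Z)) (patterns-top {n} Z∈))) ⟩
          ∑[ Z ← patterns n ρ ] Iz μ * (ipow w (∣ ρ ∣ᶻ ℤ.- ∣ μ ∣ᶻ) * weight n (x ∘ inject₁) Z)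
            ≡⟨ sumOver-cong (patterns n ρ) (λ Z _ → ℚₚ.*-assoc (Iz μ) _ _) ⟨
          ∑[ Z ← patterns n ρ ] (Iz μ * ipow w (∣ ρ ∣ᶻ ℤ.- ∣ μ ∣ᶻ)) * weight n (x ∘ inject₁) Z
            ≡⟨ sumOver-*ˡ (Iz μ * ipow w (∣ ρ ∣ᶻ ℤ.- ∣ μ ∣ᶻ)) (patterns n ρ) (weight n (x ∘ inject₁)) ⟨
          (Iz μ * ipow w (∣ ρ ∣ᶻ ℤ.- ∣ μ ∣ᶻ)) * (∑[ Z ← patterns n ρ ] weight n (x ∘ inject₁) Z) ∎))
  where
  w = x (inject₁ (fromℕ n))
  Iz : List ℕ → ℚ
  Iz μ = ipow (zOf x) (∣ top ∣ᶻ ℤ.- ∣ μ ∣ᶻ)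
  extensions : List ℕ → List ℕ → List (Pat (suc n))
  extensions μ ρ = map (λ Z → extendPat n Z μ top) (patterns n ρ)
  block : List ℕ → List (Pat (suc n))
  block μ = concatMap (extensions μ) (interlacing μ (suc n))

det-oddMatrix-base : ∀ a (x : Fin 1 → ℚ) →
                     det (oddMatrix 0 (a ∷ []) x) ≡ det (evenMatrix 1 [] x) * (∑[ z ← patterns 0 (a ∷ []) ] weight 0 x z)
det-oddMatrix-base a x = begin
  1ℚ * oddAsym z (a ℕ.+ 0) z * 1ℚ + 0ℚ
    ≡⟨ cong (λ e → 1ℚ * e * 1ℚ + 0ℚ) (oddAsym-diagonal z (a ℕ.+ 0)) ⟩
  1ℚ * (pow z (a ℕ.+ 0) * (z - inv z)) * 1ℚ + 0ℚ
    ≡⟨ cong (λ k → 1ℚ * (pow z k * (z - inv z)) * 1ℚ + 0ℚ) (sym (ℕₚ.+-identityʳ (a ℕ.+ 0))) ⟩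
  1ℚ * (pow z (a ℕ.+ 0 ℕ.+ 0) * (z - inv z)) * 1ℚ + 0ℚ
    ≡⟨ rearrange (pow z (a ℕ.+ 0 ℕ.+ 0)) z (inv z) ⟩
  (1ℚ * (z * 1ℚ - inv z * 1ℚ) * 1ℚ + 0ℚ) * (pow z (a ℕ.+ 0 ℕ.+ 0) * 1ℚ + 0ℚ) ∎
  where
  z = x zero
  rearrange : ∀ p u ui → 1ℚ * (p * (u - ui)) * 1ℚ + 0ℚ ≡ (1ℚ * (u * 1ℚ - ui * 1ℚ) * 1ℚ + 0ℚ) * (p * 1ℚ + 0ℚ)
  rearrange = solve-∀ ℚ-ring

det-oddMatrix≡∑patterns :
  ∀ n top (x : Fin (suc n) → ℚ) → (∀ i → x i ≢ 0ℚ) → IsPartition top → length top ≡ suc n →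
  det (oddMatrix n top x) ≡ det (evenMatrix (suc n) [] x) * (∑[ z ← patterns n top ] weight n x z)
det-oddMatrix≡∑patterns zero (a ∷ []) x _ _ refl = det-oddMatrix-base a x
det-oddMatrix≡∑patterns (suc n) top x x≢0 top-partition |top| = begin
  det (oddMatrix N top x)
    ≡⟨ det-oddMatrix-branch N top x x≢0 top-partition ⟩
  oddAsym z (part top N) z * (K * (∑[ μ ← interlacing top N ] Wμ μ * det (evenMatrix N μ x′)))
    ≡⟨ cong (λ s → oddAsym z (part top N) z * (K * s)) (sumOver-cong (interlacing top N) even-step) ⟩
  oddAsym z (part top N) z * (K * (∑[ μ ← interlacing top N ] Wμ μ * (B′ * X μ)))
    ≡⟨ cong₂ (λ a s → a * (K * s)) (oddAsym-diagonal z (part top N)) factor-B′ ⟩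
  pow z (part top N) * (z - inv z) * (K * (B′ * Y))
    ≡⟨ rearrange (pow z (part top N)) (z - inv z) K B′ Y ⟩
  (1ℚ * (z - inv z)) * (K * B′) * (pow z (part top N) * Y)
    ≡⟨ cong₂ (λ a q → a * (K * B′) * q) (sym (oddAsym-diagonal z 0)) weights-match ⟩
  oddAsym z 0 z * (K * B′) * (∑[ μ ← interlacing top N ] ∑[ ρ ← interlacing μ N ] (Iz μ * Iw μ ρ) * S ρ)
    ≡⟨ cong₂ _*_ (sym (det-denominator-branch n x x≢0)) (sym (∑patterns-suc n top x (x≢0 (inject₁ (fromℕ n))))) ⟩
  det (evenMatrix (suc N) [] x) * (∑[ z ← patterns N top ] weight N x z) ∎
  where
  N = suc n
  z = zOf x
  x′ = x ∘ inject₁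
  w = zOf x′
  K = prodFin (λ i → pairGap z (x′ i))
  B′ = det (evenMatrix N [] x′)
  S : List ℕ → ℚ
  S ρ = ∑[ Z ← patterns n ρ ] weight n x′ Z
  Wμ : List ℕ → ℚ
  Wμ = seqWeight (powGap z top) 0
  Wρ : List ℕ → List ℕ → ℚ
  Wρ μ = seqWeight (powGap (inv w) μ) 0
  Iz : List ℕ → ℚ
  Iz μ = ipow z (∣ top ∣ᶻ ℤ.- ∣ μ ∣ᶻ)
  Iw : List ℕ → List ℕ → ℚ
  Iw μ ρ = ipow w (∣ ρ ∣ᶻ ℤ.- ∣ μ ∣ᶻ)
  X : List ℕ → ℚ
  X μ = ∑[ ρ ← interlacing μ N ] Wρ μ ρ * S ρ
  Y = ∑[ μ ← interlacing top N ] Wμ μ * X μ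
  swap-B′ : ∀ a b c → a * (b * c) ≡ b * (a * c)
  swap-B′ = solve-∀ ℚ-ring
  rearrange : ∀ p e k b y → p * e * (k * (b * y)) ≡ (1ℚ * e) * (k * b) * (p * y)
  rearrange = solve-∀ ℚ-ring
  μ≺top : ∀ {μ} → μ ∈ interlacing top N → μ ≺ top
  μ≺top = interlacing⇒≺ {top} top-partition (ℕₚ.≤-reflexive |top|)
  ρ≺μ : ∀ {μ ρ} → μ ∈ interlacing top N → ρ ∈ interlacing μ N → ρ ≺ μ
  ρ≺μ {μ} μ∈ = interlacing⇒≺ {μ} (≺⇒partition {μ} {top} (μ≺top μ∈))
                                  (ℕₚ.≤-trans (ℕₚ.≤-reflexive (length-interlacing {top} μ∈)) (ℕₚ.n≤1+n N))
  even-step : ∀ μ → μ ∈ interlacing top N → Wμ μ * det (evenMatrix N μ x′) ≡ Wμ μ * (B′ * X μ)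
  even-step μ μ∈ = cong (Wμ μ *_) (begin
    det (evenMatrix N μ x′)
      ≡⟨ det-evenMatrix-branch n μ x′ (≺⇒partition {μ} {top} (μ≺top μ∈))
                                       (part-beyond μ N (ℕₚ.≤-reflexive (length-interlacing {top} μ∈))) ⟩
    ∑[ ρ ← interlacing μ N ] Wρ μ ρ * det (oddMatrix n ρ x′)
      ≡⟨ sumOver-cong (interlacing μ N) (λ ρ ρ∈ → trans
           (cong (Wρ μ ρ *_) (det-oddMatrix≡∑patterns n ρ x′ (x≢0 ∘ inject₁)
                                (≺⇒partition {ρ} {μ} (ρ≺μ μ∈ ρ∈)) (length-interlacing {μ} ρ∈)))
           (swap-B′ (Wρ μ ρ) B′ (S ρ))) ⟩
    ∑[ ρ ← interlacing μ N ] B′ * (Wρ μ ρ * S ρ)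
      ≡⟨ sumOver-*ˡ B′ (interlacing μ N) (λ ρ → Wρ μ ρ * S ρ) ⟨
    B′ * X μ ∎)
  factor-B′ : ∑[ μ ← interlacing top N ] Wμ μ * (B′ * X μ) ≡ B′ * Y
  factor-B′ = trans (sumOver-cong (interlacing top N) (λ μ _ → swap-B′ (Wμ μ) B′ (X μ)))
                    (sym (sumOver-*ˡ B′ (interlacing top N) (λ μ → Wμ μ * X μ)))
  Wμ≡Iz : ∀ μ → μ ∈ interlacing top N → pow z (part top N) * Wμ μ ≡ Iz μ
  Wμ≡Iz μ μ∈ = trans (cong (λ k → pow z (part top k) * Wμ μ) (sym |μ|))
                     (seqWeight-powGap-shorter z top μ (trans |top| (cong suc (sym |μ|))) (λ i → proj₁ (μ≺top μ∈ i)))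
    where
    |μ| = length-interlacing {top} {N} μ∈
  Wρ≡Iw : ∀ μ ρ → μ ∈ interlacing top N → ρ ∈ interlacing μ N → Wρ μ ρ ≡ Iw μ ρ
  Wρ≡Iw μ ρ μ∈ ρ∈ = seqWeight-powGap-inv w μ ρ (trans (length-interlacing {μ} {N} ρ∈) (sym (length-interlacing {top} {N} μ∈)))
                                         (λ i → proj₁ (ρ≺μ μ∈ ρ∈ i))
  weights-match : pow z (part top N) * Y ≡ ∑[ μ ← interlacing top N ] ∑[ ρ ← interlacing μ N ] (Iz μ * Iw μ ρ) * S ρ
  weights-match = begin
    pow z (part top N) * Y
      ≡⟨ sumOver-*ˡ (pow z (part top N)) (interlacing top N) (λ μ → Wμ μ * X μ) ⟩
    ∑[ μ ← interlacing top N ] pow z (part top N) * (Wμ μ * X μ)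
      ≡⟨ sumOver-cong (interlacing top N) (λ μ μ∈ →
           trans (sym (ℚₚ.*-assoc (pow z (part top N)) (Wμ μ) (X μ))) (cong (_* X μ) (Wμ≡Iz μ μ∈))) ⟩
    ∑[ μ ← interlacing top N ] Iz μ * X μ
      ≡⟨ sumOver-cong (interlacing top N) (λ μ μ∈ → trans (sumOver-*ˡ (Iz μ) (interlacing μ N) (λ ρ → Wρ μ ρ * S ρ))
           (sumOver-cong (interlacing μ N) (λ ρ ρ∈ → trans (sym (ℚₚ.*-assoc (Iz μ) (Wρ μ ρ) (S ρ)))
                                                           (cong (λ c → Iz μ * c * S ρ) (Wρ≡Iw μ ρ μ∈ ρ∈))))) ⟩
    ∑[ μ ← interlacing top N ] ∑[ ρ ← interlacing μ N ] (Iz μ * Iw μ ρ) * S ρ ∎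

+-suc-∸ : ∀ n (j : Fin (suc n)) a → a ℕ.+ (suc n ∸ toℕ j) ≡ suc (a ℕ.+ (n ∸ toℕ j))
+-suc-∸ n j a = trans (cong (a ℕ.+_) (ℕₚ.+-∸-assoc 1 (ℕₚ.≤-pred (Finₚ.toℕ<n j)))) (ℕₚ.+-suc a (n ∸ toℕ j))

aMat≗oddMatrix : ∀ n la (x : Fin (suc n) → ℚ) → (∀ i → x i ≢ 0ℚ) →
                 ∀ i j → aMat n (λ j → part la (toℕ j)) x i j ≡ oddMatrix n la x i j
aMat≗oddMatrix n la x x≢0 i j with i Fin.≟ fromℕ n
... | yes refl = begin
  ipow z (ℤ.+ p) - ipow z (ℤ.+ p ℤ.- ℤ.+ 2)  ≡⟨ cong (λ k → ipow z (ℤ.+ k) - ipow z (ℤ.+ k ℤ.- ℤ.+ 2)) p≡1+q ⟩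
  z * pow z q - ipow z (suc q ⊖ 2)           ≡⟨ cong (λ e → z * pow z q - ipow z e) (ℤₚ.[1+m]⊖[1+n]≡m⊖n q 1) ⟩
  z * pow z q - ipow z (q ⊖ 1)               ≡⟨ cong (λ e → z * pow z q - e) (ipow-⊖ z (x≢0 (fromℕ n)) q 1) ⟩
  z * pow z q - pow z q * (inv z * 1ℚ)       ≡⟨ factor z (inv z) (pow z q) ⟩
  pow z q * (z - inv z)                      ≡⟨ oddAsym-diagonal z q ⟨
  oddAsym z q z                              ∎
  where
  z = zOf x
  p = part la (toℕ j) ℕ.+ (suc n ∸ toℕ j)
  q = part la (toℕ j) ℕ.+ (n ∸ toℕ j)
  p≡1+q : p ≡ suc q
  p≡1+q = +-suc-∸ n j (part la (toℕ j))
  factor : ∀ u ui P → u * P - P * (ui * 1ℚ) ≡ P * (u - ui)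
  factor = solve-∀ ℚ-ring
... | no _ = begin
  dif (x i) (ℤ.+ p) - inv (zOf x) * dif (x i) (ℤ.+ q)   ≡⟨ cong (λ k → dif (x i) (ℤ.+ k) - inv (zOf x) * dif (x i) (ℤ.+ q)) p≡1+q ⟩
  dif (x i) (ℤ.+ suc q) - inv (zOf x) * dif (x i) (ℤ.+ q) ≡⟨ cong (λ d → asym (x i) (suc q) - inv (zOf x) * d) (dif-asym (x i) q) ⟩
  oddAsym (zOf x) q (x i)                               ∎
  where
  p = part la (toℕ j) ℕ.+ (suc n ∸ toℕ j)
  q = part la (toℕ j) ℕ.+ (n ∸ toℕ j)
  p≡1+q : p ≡ suc q
  p≡1+q = +-suc-∸ n j (part la (toℕ j))

bMat≗evenMatrix : ∀ n (x : Fin (suc n) → ℚ) i j → bMat n x i j ≡ evenMatrix (suc n) [] x i j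
bMat≗evenMatrix n x i j with i Fin.≟ fromℕ n
... | yes refl = dif-asym (zOf x) (suc n ∸ toℕ j)
... | no _ = dif-asym (x i) (suc n ∸ toℕ j)

extend-partition : ∀ {n} (la : Vec ℕ n) → IsPartition (toList la) → IsPartition (extend la)
extend-partition la la-partition i =
  subst₂ _≤_ (sym (part-++-[0] (toList la) (suc i))) (sym (part-++-[0] (toList la) i)) (la-partition i)

length-extend : ∀ {n} (la : Vec ℕ n) → length (extend la) ≡ suc n
length-extend {n} la = trans (Listₚ.length-++ (toList la)) (trans (cong (ℕ._+ 1) (Vecₚ.length-toList la)) (ℕₚ.+-comm n 1))

GTLayers⇒ValidGT : ∀ n (la : Vec ℕ n) z → IsPartition (toList la) → GTLayers (suc (2 ℕ.* n)) (extend la) (toList z) → ValidGT n la z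
GTLayers⇒ValidGT n la z la-partition layers = record
  { lengths = λ k → trans (cong length (lookup≡layer z k)) (layer-lengths (toℕ k) (ℕₚ.≤-pred (Finₚ.toℕ<n k)))
  ; partitions = λ k → subst IsPartition (sym (lookup≡layer z k)) (layer-partition (toℕ k) (ℕₚ.≤-pred (Finₚ.toℕ<n k)))
  ; bottom = trans (zAt≡layer n z 0) bottom-layer
  ; top = trans (zAt≡layer n z _) top-layer
  ; interlace = interlace′
  ; symplectic = λ k k< i _ → let (μᵢ≤ , ≤μᵢ) = interlace′ k k< i in ≤μᵢ , μᵢ≤
  }
  where
  open GTLayers layers
  interlace′ : ∀ k → k < suc (2 ℕ.* n) → zAt n z k ≺ zAt n z (suc k)
  interlace′ k k< = subst₂ _≺_ (sym (zAt≡layer n z k)) (sym (zAt≡layer n z (suc k))) (interlace k k<)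
  layer-partition : ∀ k → k ≤ suc (2 ℕ.* n) → IsPartition (layer (toList z) k)
  layer-partition k k≤ with ℕₚ.m≤n⇒m<n∨m≡n k≤
  ... | inj₁ k< = ≺⇒partition {layer (toList z) k} {layer (toList z) (suc k)} (interlace k k<)
  ... | inj₂ refl = subst IsPartition (sym top-layer) (extend-partition la la-partition)

ValidGT⇒GTLayers : ∀ n (la : Vec ℕ n) z → ValidGT n la z → GTLayers (suc (2 ℕ.* n)) (extend la) (toList z)
ValidGT⇒GTLayers n la z valid = record
  { length-layers = Vecₚ.length-toList z
  ; layer-lengths = λ k k≤ → begin
      length (layer (toList z) k)            ≡⟨ cong (length ∘ layer (toList z)) (Finₚ.toℕ-fromℕ< (s≤s k≤)) ⟨
      length (layer (toList z) (toℕ (fromℕ< (s≤s k≤)))) ≡⟨ cong length (lookup≡layer z (fromℕ< (s≤s k≤))) ⟨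
      length (lookup z (fromℕ< (s≤s k≤)))     ≡⟨ lengths (fromℕ< (s≤s k≤)) ⟩
      ⌈ toℕ (fromℕ< (s≤s k≤)) /2⌉              ≡⟨ cong ⌈_/2⌉ (Finₚ.toℕ-fromℕ< (s≤s k≤)) ⟩
      ⌈ k /2⌉                                 ∎
  ; bottom-layer = trans (sym (zAt≡layer n z 0)) bottom
  ; top-layer = trans (sym (zAt≡layer n z _)) top
  ; interlace = λ k k< → subst₂ _≺_ (zAt≡layer n z k) (zAt≡layer n z (suc k)) (interlace k k<)
  }
  where
  open ValidGT valid

inv-cancelʳ : ∀ b s → b ≢ 0ℚ → (b * s) * inv b ≡ s
inv-cancelʳ b s b≢0 = begin
  (b * s) * inv b    ≡⟨ swap b s (inv b) ⟩
  s * (b * inv b)    ≡⟨ cong (s *_) (inv-inverseʳ b b≢0) ⟩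
  s * 1ℚ             ≡⟨ ℚₚ.*-identityʳ s ⟩
  s                  ∎
  where
  swap : ∀ a c d → (a * c) * d ≡ c * (a * d)
  swap = solve-∀ ℚ-ring

sp≡∑patterns : ∀ n la (x : Fin (suc n) → ℚ) → IsPartition la → length la ≡ suc n →
               (∀ i → x i ≢ 0ℚ) → det (bMat n x) ≢ 0ℚ →
               sp n (λ j → part la (toℕ j)) x ≡ ∑[ z ← patterns n la ] weight n x z
sp≡∑patterns n la x la-partition |la| x≢0 detB≢0 = begin
  det (aMat n (λ j → part la (toℕ j)) x) * inv (det (bMat n x))
    ≡⟨ cong₂ (λ a b → a * inv b) (det-cong (aMat≗oddMatrix n la x x≢0)) (sym B≡detB) ⟩
  det (oddMatrix n la x) * inv B
    ≡⟨ cong (_* inv B) (det-oddMatrix≡∑patterns n la x x≢0 la-partition |la|) ⟩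
  (B * (∑[ z ← patterns n la ] weight n x z)) * inv B
    ≡⟨ inv-cancelʳ B _ (λ B≡0 → detB≢0 (trans (sym B≡detB) B≡0)) ⟩
  ∑[ z ← patterns n la ] weight n x z ∎
  where
  B = det (evenMatrix (suc n) [] x)
  B≡detB : B ≡ det (bMat n x)
  B≡detB = det-cong (λ i j → sym (bMat≗evenMatrix n x i j))

mainTheorem8 : (n : ℕ) (la : Vec ℕ n) → IsPartition (toList la) →
    Σ (List (Pat n)) (λ L →
      Unique L
      × (∀ (z : Pat n) → (z ∈ L → ValidGT n la z) × (ValidGT n la z → z ∈ L))
      × ((x : Fin (suc n) → ℚ) → (∀ i → x i ≢ 0ℚ) → det (bMat n x) ≢ 0ℚ →
           sp n (laCol la) x ≡ sumList (map (weight n x) L)))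
mainTheorem8 n la la-partition =
  patterns n (extend la) ,
  patterns-unique n (extend la) ,
  (λ z → (λ z∈ → GTLayers⇒ValidGT n la z la-partition (patterns-sound n λ-partition (length-extend la) z∈))
       , (λ valid → patterns-complete n (ValidGT⇒GTLayers n la z valid))) ,
  (λ x x≢0 detB≢0 → sp≡∑patterns n (extend la) x λ-partition (length-extend la) x≢0 detB≢0)
  where
  λ-partition = extend-partition la la-partition
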